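{- Let $\mathbf{f}$ be the Fibonacci word, $\phi=\frac{1+\sqrt5}{2}$, and $F_n$ the $n$-th Fibonacci number. Fix a positive integer $n$ and a positive integer $\ell$. If $$\phi^{ -n+1}\le \min\left(\{2\ell F_n\phi\},\,1-\{2\ell F_n\phi\}\right),$$ then $\mathbf{f}_{[x,x+2F_n]}\neq \mathbf{f}_{[x+2\ell F_n,\,x+2\ell F_n+2F_n]}$ for every integer $x\ge 0$.
   Context: The Fibonacci word is $\mathbf{f}=\sigma^{\omega}(0)$ where $\sigma(0)=01$, $\sigma(1)=0$ (the infinite word having each $\sigma^n(0)$ as a prefix), indexed from $0$. For a word $v$, $v_{[i,j]}$ denotes $v_iv_{i+1}\cdots v_{j-1}$. Fibonacci numbers: $F_1=F_2=1$, $F_n=F_{n-1}+F_{n-2}$. $\{y\}$ denotes the fractional part of a real number $y$. -}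

module Defs where

open import Data.Nat as ℕ using (ℕ; zero; suc)
open import Data.Integer as ℤ using (ℤ; +_)
open import Data.List using (List; []; _∷_; _++_; map; upTo; concatMap)
open import Data.Product using (_×_; _,_)
open import Data.Sum using (_⊎_)
open import Relation.Binary.PropositionalEquality using (_≢_)

F : ℕ → ℕ
F zero = 0
F (suc zero) = 1
F (suc (suc n)) = F (suc n) ℕ.+ F n

-- The Fibonacci word f = σ^ω(0), σ(0) = 01, σ(1) = 0, indexed from 0.

σ₁ : ℕ → List ℕ
σ₁ zero = 0 ∷ 1 ∷ []
σ₁ (suc _) = 0 ∷ []

σ : List ℕ → List ℕ
σ = concatMap σ₁

σ^ : ℕ → List ℕ → List ℕ
σ^ zero w = w
σ^ (suc k) w = σ (σ^ k w)

nth : List ℕ → ℕ → ℕ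
nth [] _ = 0
nth (a ∷ w) zero = a
nth (a ∷ w) (suc i) = nth w i

-- f_i is the i-th letter of σ^(i+1)(0), a prefix of f of length F_(i+3) > i.
fibword : ℕ → ℕ
fibword i = nth (σ^ (suc i) (0 ∷ [])) i

-- v_[i,j] = v_i v_(i+1) ⋯ v_(j-1)
factor : ℕ → ℕ → List ℕ
factor i j = map (λ k → fibword (i ℕ.+ k)) (upTo (j ℕ.∸ i))

-- Exact arithmetic in ℤ[φ], φ = (1+√5)/2:  the pair (a , b) denotes a + bφ.

ℤφ : Set
ℤφ = ℤ × ℤ

fromℤ : ℤ → ℤφ
fromℤ a = a , + 0

φ : ℤφ
φ = + 0 , + 1

_+φ_ : ℤφ → ℤφ → ℤφ
(a , b) +φ (c , d) = a ℤ.+ c , b ℤ.+ d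

-φ_ : ℤφ → ℤφ
-φ (a , b) = ℤ.- a , ℤ.- b

_-φ_ : ℤφ → ℤφ → ℤφ
x -φ y = x +φ (-φ y)

-- (a + bφ)(c + dφ) = (ac + bd) + (ad + bc + bd)φ   using φ² = φ + 1
_*φ_ : ℤφ → ℤφ → ℤφ
(a , b) *φ (c , d) = a ℤ.* c ℤ.+ b ℤ.* d , a ℤ.* d ℤ.+ b ℤ.* c ℤ.+ b ℤ.* d

-- φinvPow k = φ^(-k) = (φ - 1)^k, since φ⁻¹ = φ - 1
φinvPow : ℕ → ℤφ
φinvPow zero = fromℤ (+ 1)
φinvPow (suc k) = (φ -φ fromℤ (+ 1)) *φ (φinvPow k)

-- The real order on ℤ[φ]:  a + bφ = (p + q√5)/2 with p = 2a + b, q = b,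
-- and p + q√5 ≥ 0 is decided by signs and comparing p² with 5q².
NonNeg√5 : ℤ → ℤ → Set
NonNeg√5 p q =
  (+ 0 ℤ.≤ p × + 0 ℤ.≤ q)
  ⊎ (+ 0 ℤ.≤ p × q ℤ.< + 0 × + 5 ℤ.* (q ℤ.* q) ℤ.≤ p ℤ.* p)
  ⊎ (p ℤ.< + 0 × + 0 ℤ.≤ q × p ℤ.* p ℤ.≤ + 5 ℤ.* (q ℤ.* q))

NonNegφ : ℤφ → Set
NonNegφ (a , b) = NonNeg√5 (+ 2 ℤ.* a ℤ.+ b) b

_≤φ_ : ℤφ → ℤφ → Set
x ≤φ y = NonNegφ (y -φ x)

_<φ_ : ℤφ → ℤφ → Set
x <φ y = NonNegφ (y -φ x) × (x ≢ y)

infixl 7 _*φ_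
infixl 6 _+φ_ _-φ_
infix 4 _≤φ_ _<φ_

module Submission where

open import Defs
open import Data.Nat using (ℕ; _+_; _*_; _∸_; _≥_)
open import Data.Integer as ℤ using (ℤ; +_)
open import Data.Product using (_×_)
open import Relation.Binary.PropositionalEquality using (_≢_)
open import Data.Nat using (zero; suc)
open import Data.Product using (proj₁; proj₂; uncurry)

-- Computing ⌊jφ⌋ through its increments
-- δ j ∈ {1, 2}, the Fibonacci word is the Beatty word f_i = 2 - δ (i + 1), because σ maps the
-- occurrence of a factor at j to an occurrence at ⌊(j + 1)φ⌋ - 1.
-- If f_[x, x+2F_n] = f_[x+m, x+m+2F_n] with m = 2ℓF_n, then δ is m-periodic on [x + 1, x + 2F_n],
-- so the carry e in ⌊(y + m)φ⌋ = ⌊yφ⌋ + ⌊mφ⌋ + e is the same for all y in [x + 1, x + 1 + 2F_n].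
-- But the fractional parts {yφ} of F_(n+1) consecutive y meet every interval of length φ^(-n+1):
-- since φ^(-k) = ±(F_(k+1) - F_k φ), shifting y by F_n or F_(n-1) in the right direction raises {yφ}
-- by φ^(-n) or φ^(-n+1), and such a walk stays among F_(n+1) consecutive values.  So by the
-- hypothesis some y has {yφ} + {mφ} < 1 (carry 0) and another has {yφ} + {mφ} ≥ 1 (carry 1).

module SurdBounds where

  open import Data.Nat
  open import Data.Nat.Properties
  open import Data.Nat.Divisibility using (_∣_; divides)
  open import Data.Nat.Primality using (prime?; euclidsLemma)
  open import Data.Nat.Induction using (<-rec)
  open import Data.Nat.Tactic.RingSolver using (solve; solve-∀)
  open import Data.List using (_∷_; [])
  open import Data.Product using (∃-syntax; _×_; _,_)
  open import Data.Sum using (inj₁; inj₂)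
  open import Data.Empty using (⊥; ⊥-elim)
  open import Relation.Nullary using (yes; no; contradiction)
  open import Relation.Nullary.Decidable using (from-yes)
  open import Relation.Binary.PropositionalEquality

  infix 4 _√5≤_ _≤√5_

  -- Q √5≤ P  and  P ≤√5 Q  stand for  Q√5 ≤ P  and  P ≤ Q√5.
  _√5≤_ : ℕ → ℕ → Set
  Q √5≤ P = 5 * (Q * Q) ≤ P * P

  _≤√5_ : ℕ → ℕ → Set
  P ≤√5 Q = P * P ≤ 5 * (Q * Q)

  m*m≤n*n⇒m≤n : ∀ {m n} → m * m ≤ n * n → m ≤ n
  m*m≤n*n⇒m≤n {m} {n} h with m ≤? n
  ... | yes m≤n = m≤n
  ... | no m≰n = contradiction h (<⇒≱ (*-mono-< n<m n<m))
    where n<m = ≰⇒> m≰n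

  *-self-mono-≤ : ∀ {m n} → m ≤ n → m * m ≤ n * n
  *-self-mono-≤ h = *-mono-≤ h h

  √5≤-mono : ∀ {P Q P′ Q′} → Q √5≤ P → P ≤ P′ → Q′ ≤ Q → Q′ √5≤ P′
  √5≤-mono h P≤P′ Q′≤Q =
    ≤-trans (*-monoʳ-≤ 5 (*-self-mono-≤ Q′≤Q)) (≤-trans h (*-self-mono-≤ P≤P′))

  ≤√5-mono : ∀ {P Q P′ Q′} → P ≤√5 Q → P′ ≤ P → Q ≤ Q′ → P′ ≤√5 Q′
  ≤√5-mono h P′≤P Q≤Q′ =
    ≤-trans (*-self-mono-≤ P′≤P) (≤-trans h (*-monoʳ-≤ 5 (*-self-mono-≤ Q≤Q′)))

  private
    5Q*5Q≡5*5QQ : ∀ Q → 5 * Q * (5 * Q) ≡ 5 * (5 * (Q * Q))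
    5Q*5Q≡5*5QQ = solve-∀

    2m*2m≡4*m*m : ∀ m → (m + m) * (m + m) ≡ 4 * (m * m)
    2m*2m≡4*m*m = solve-∀

    5*2m*2m≡4*5*m*m : ∀ m → 5 * ((m + m) * (m + m)) ≡ 4 * (5 * (m * m))
    5*2m*2m≡4*5*m*m = solve-∀

  ≤√5⇒√5≤ : ∀ P Q → P ≤√5 Q → P √5≤ 5 * Q
  ≤√5⇒√5≤ P Q h = subst (5 * (P * P) ≤_) (sym (5Q*5Q≡5*5QQ Q)) (*-monoʳ-≤ 5 h)

  √5≤⇒≤√5 : ∀ P Q → P √5≤ 5 * Q → P ≤√5 Q
  √5≤⇒≤√5 P Q h = *-cancelˡ-≤ 5 (subst (5 * (P * P) ≤_) (5Q*5Q≡5*5QQ Q) h)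

  √5≤⇒5*≤√5 : ∀ P Q → Q √5≤ P → 5 * Q ≤√5 P
  √5≤⇒5*≤√5 P Q h = subst (_≤ 5 * (P * P)) (sym (5Q*5Q≡5*5QQ Q)) (*-monoʳ-≤ 5 h)

  √5≤-+ : ∀ {P Q R S} → Q √5≤ P → S √5≤ R → Q + S √5≤ P + R
  √5≤-+ {P} {Q} {R} {S} h₁ h₂ = begin
    5 * ((Q + S) * (Q + S))                      ≡⟨ solve (Q ∷ S ∷ []) ⟩
    5 * (Q * Q) + 2 * (5 * Q * S) + 5 * (S * S)  ≤⟨ +-mono-≤ (+-mono-≤ h₁ (*-monoʳ-≤ 2 cross)) h₂ ⟩
    P * P + 2 * (P * R) + R * R                  ≡⟨ solve (P ∷ R ∷ []) ⟩
    (P + R) * (P + R)                            ∎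
    where
    open ≤-Reasoning
    cross : 5 * Q * S ≤ P * R
    cross = m*m≤n*n⇒m≤n (begin
      5 * Q * S * (5 * Q * S)        ≡⟨ solve (Q ∷ S ∷ []) ⟩
      5 * (Q * Q) * (5 * (S * S))    ≤⟨ *-mono-≤ h₁ h₂ ⟩
      P * P * (R * R)                ≡⟨ solve (P ∷ R ∷ []) ⟩
      P * R * (P * R)                ∎)

  ≤√5-+ : ∀ {P Q R S} → P ≤√5 Q → R ≤√5 S → P + R ≤√5 Q + S
  ≤√5-+ {P} {Q} {R} {S} h₁ h₂ = √5≤⇒≤√5 (P + R) (Q + S)
    (subst (P + R √5≤_) (sym (*-distribˡ-+ 5 Q S))
      (√5≤-+ {5 * Q} {P} {5 * S} {R} (≤√5⇒√5≤ P Q h₁) (≤√5⇒√5≤ R S h₂)))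

  √5≤-cancel : ∀ {R S u v} → S + v √5≤ R + u → R ≤√5 S → v √5≤ u
  √5≤-cancel {R} {S} {u} {v} h₁ h₂ with 5 * (v * v) ≤? u * u
  ... | yes v√5≤u = v√5≤u
  ... | no v√5≰u = contradiction h₁ (<⇒≱ sum<)
    where
    open ≤-Reasoning
    u<v√5 : u * u < 5 * (v * v)
    u<v√5 = ≰⇒> v√5≰u
    cross : R * u ≤ 5 * S * v
    cross = m*m≤n*n⇒m≤n (begin
      R * u * (R * u)                ≡⟨ solve (R ∷ u ∷ []) ⟩
      R * R * (u * u)                ≤⟨ *-mono-≤ h₂ (<⇒≤ u<v√5) ⟩
      5 * (S * S) * (5 * (v * v))    ≡⟨ solve (S ∷ v ∷ []) ⟩
      5 * S * v * (5 * S * v)        ∎)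
    sum< : (R + u) * (R + u) < 5 * ((S + v) * (S + v))
    sum< = begin-strict
      (R + u) * (R + u)                            ≡⟨ solve (R ∷ u ∷ []) ⟩
      R * R + 2 * (R * u) + u * u                  <⟨ +-mono-≤-< (+-mono-≤ h₂ (*-monoʳ-≤ 2 cross)) u<v√5 ⟩
      5 * (S * S) + 2 * (5 * S * v) + 5 * (v * v)  ≡⟨ solve (S ∷ v ∷ []) ⟩
      5 * ((S + v) * (S + v))                      ∎

  ≤√5-cancel : ∀ {P Q u v} → Q √5≤ P → P + u ≤√5 Q + v → u ≤√5 v
  ≤√5-cancel {P} {Q} {u} {v} h₁ h₂ = √5≤⇒≤√5 u v (√5≤-cancel {5 * Q} {P} {5 * v} {u}
    (subst (P + u √5≤_) (*-distribˡ-+ 5 Q v) (≤√5⇒√5≤ (P + u) (Q + v) h₂)) (√5≤⇒5*≤√5 P Q h₁))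

  √5≤-half : ∀ {P Q} → Q + Q √5≤ P + P → Q √5≤ P
  √5≤-half {P} {Q} h = *-cancelˡ-≤ 4 (subst₂ _≤_ (5*2m*2m≡4*5*m*m Q) (2m*2m≡4*m*m P) h)

  ≤√5-half : ∀ {P Q} → P + P ≤√5 Q + Q → P ≤√5 Q
  ≤√5-half {P} {Q} h = *-cancelˡ-≤ 4 (subst₂ _≤_ (2m*2m≡4*m*m P) (5*2m*2m≡4*5*m*m Q) h)

  √5≤-<-≤√5-<-irrefl : ∀ {P Q R S} → Q √5≤ P → P < R → R ≤√5 S → S < Q → ⊥
  √5≤-<-≤√5-<-irrefl {P} {Q} {R} {S} h₁ P<R h₂ S<Q = <-irrefl refl (begin-strict
    R * R        ≤⟨ h₂ ⟩
    5 * (S * S)  <⟨ *-monoʳ-< 5 (*-mono-< S<Q S<Q) ⟩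
    5 * (Q * Q)  ≤⟨ h₁ ⟩
    P * P        <⟨ *-mono-< P<R P<R ⟩
    R * R        ∎)
    where open ≤-Reasoning

  5∣m*m⇒m≡5*k : ∀ m → 5 ∣ m * m → ∃[ k ] m ≡ 5 * k
  5∣m*m⇒m≡5*k m 5∣m*m with euclidsLemma m m (from-yes (prime? 5)) 5∣m*m
  ... | inj₁ (divides k m≡k*5) = k , trans m≡k*5 (*-comm k 5)
  ... | inj₂ (divides k m≡k*5) = k , trans m≡k*5 (*-comm k 5)

  X*X≡5*Y*Y⇒Y*Y≡5*X′*X′ : ∀ X Y → X * X ≡ 5 * (Y * Y) →
                          ∃[ X′ ] X ≡ 5 * X′ × Y * Y ≡ 5 * (X′ * X′)
  X*X≡5*Y*Y⇒Y*Y≡5*X′*X′ X Y eq with 5∣m*m⇒m≡5*k X (divides (Y * Y) (trans eq (*-comm 5 (Y * Y))))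
  ... | X′ , refl = X′ , refl , sym (*-cancelˡ-≡ _ _ 5 (trans (sym (5Q*5Q≡5*5QQ X′)) eq))

  √5-irrational : ∀ Y X → X * X ≡ 5 * (Y * Y) → Y ≡ 0
  √5-irrational = <-rec _ descent
    where
    descent : ∀ Y → (∀ {Y′} → Y′ < Y → ∀ X → X * X ≡ 5 * (Y′ * Y′) → Y′ ≡ 0) →
              ∀ X → X * X ≡ 5 * (Y * Y) → Y ≡ 0
    descent zero    _   _ _  = refl
    descent (suc y) rec X eq with X*X≡5*Y*Y⇒Y*Y≡5*X′*X′ X (suc y) eq
    ... | X′ , _ , eq′ with X*X≡5*Y*Y⇒Y*Y≡5*X′*X′ (suc y) X′ eq′
    ... | zero , () , _
    ... | Y′@(suc _) , Y≡5Y′ , eq″ = ⊥-elim (1+n≢0 (rec Y′<Y X′ eq″))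
      where
      Y′<Y : Y′ < suc y
      Y′<Y = subst (Y′ <_) (trans (*-comm Y′ 5) (sym Y≡5Y′)) (m<m*n Y′ 5 (s≤s (s≤s z≤n)))


module SurdSign where

  open import Data.Nat as ℕ using (ℕ; zero; suc)
  import Data.Nat.Properties as ℕP
  open import Data.Integer as ℤ using (ℤ; +_; -[1+_]; _⊖_)
  import Data.Integer.Properties as ℤP
  open import Data.Product using (∃-syntax; _×_; _,_)
  open import Data.Sum using (_⊎_; inj₁; inj₂)
  open import Data.Unit using (⊤; tt)
  open import Data.Empty using (⊥; ⊥-elim)
  open import Relation.Nullary using (Dec; yes; no)
  open import Relation.Binary.PropositionalEquality
  open SurdBounds

  -- p + q√5 ≥ 0, decided by the signs of p and q and a comparison of squares in ℕ
  NonNeg√5′ : ℤ → ℤ → Set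
  NonNeg√5′ (+ P)    (+ Q)    = ⊤
  NonNeg√5′ (+ P)    -[1+ Q ] = suc Q √5≤ P
  NonNeg√5′ -[1+ P ] (+ Q)    = suc P ≤√5 Q
  NonNeg√5′ -[1+ P ] -[1+ Q ] = ⊥

  i*i≡∣i∣*∣i∣ : ∀ i → i ℤ.* i ≡ + (ℤ.∣ i ∣ ℕ.* ℤ.∣ i ∣)
  i*i≡∣i∣*∣i∣ (+ n)    = sym (ℤP.pos-* n n)
  i*i≡∣i∣*∣i∣ -[1+ n ] = ℤP.+◃n≡+n (suc n ℕ.* suc n)

  5*i*i≡5*∣i∣*∣i∣ : ∀ i → + 5 ℤ.* (i ℤ.* i) ≡ + (5 ℕ.* (ℤ.∣ i ∣ ℕ.* ℤ.∣ i ∣))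
  5*i*i≡5*∣i∣*∣i∣ i =
    trans (cong (+ 5 ℤ.*_) (i*i≡∣i∣*∣i∣ i)) (sym (ℤP.pos-* 5 (ℤ.∣ i ∣ ℕ.* ℤ.∣ i ∣)))

  NonNeg√5⇒NonNeg√5′ : ∀ p q → NonNeg√5 p q → NonNeg√5′ p q
  NonNeg√5⇒NonNeg√5′ (+ P) (+ Q) _ = tt
  NonNeg√5⇒NonNeg√5′ (+ P) -[1+ Q ] (inj₁ (_ , ()))
  NonNeg√5⇒NonNeg√5′ (+ P) -[1+ Q ] (inj₂ (inj₁ (_ , _ , 5q²≤p²))) =
    ℤP.drop‿+≤+ (subst₂ ℤ._≤_ (5*i*i≡5*∣i∣*∣i∣ -[1+ Q ]) (i*i≡∣i∣*∣i∣ (+ P)) 5q²≤p²)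
  NonNeg√5⇒NonNeg√5′ (+ P) -[1+ Q ] (inj₂ (inj₂ (ℤ.+<+ () , _ , _)))
  NonNeg√5⇒NonNeg√5′ -[1+ P ] (+ Q) (inj₁ (() , _))
  NonNeg√5⇒NonNeg√5′ -[1+ P ] (+ Q) (inj₂ (inj₁ (() , _)))
  NonNeg√5⇒NonNeg√5′ -[1+ P ] (+ Q) (inj₂ (inj₂ (_ , _ , p²≤5q²))) =
    ℤP.drop‿+≤+ (subst₂ ℤ._≤_ (i*i≡∣i∣*∣i∣ -[1+ P ]) (5*i*i≡5*∣i∣*∣i∣ (+ Q)) p²≤5q²)
  NonNeg√5⇒NonNeg√5′ -[1+ P ] -[1+ Q ] (inj₁ (() , _))
  NonNeg√5⇒NonNeg√5′ -[1+ P ] -[1+ Q ] (inj₂ (inj₁ (() , _)))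
  NonNeg√5⇒NonNeg√5′ -[1+ P ] -[1+ Q ] (inj₂ (inj₂ (_ , () , _)))

  NonNeg√5′⇒NonNeg√5 : ∀ p q → NonNeg√5′ p q → NonNeg√5 p q
  NonNeg√5′⇒NonNeg√5 (+ P) (+ Q) _ = inj₁ (ℤ.+≤+ ℕ.z≤n , ℤ.+≤+ ℕ.z≤n)
  NonNeg√5′⇒NonNeg√5 (+ P) -[1+ Q ] h = inj₂ (inj₁ (ℤ.+≤+ ℕ.z≤n , ℤ.-<+ ,
    subst₂ ℤ._≤_ (sym (5*i*i≡5*∣i∣*∣i∣ -[1+ Q ])) (sym (i*i≡∣i∣*∣i∣ (+ P))) (ℤ.+≤+ h)))
  NonNeg√5′⇒NonNeg√5 -[1+ P ] (+ Q) h = inj₂ (inj₂ (ℤ.-<+ , ℤ.+≤+ ℕ.z≤n ,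
    subst₂ ℤ._≤_ (sym (i*i≡∣i∣*∣i∣ -[1+ P ])) (sym (5*i*i≡5*∣i∣*∣i∣ (+ Q))) (ℤ.+≤+ h)))

  ⊖-cases : ∀ m n → (∃[ k ] n ℕ.+ k ≡ m × m ⊖ n ≡ + k)
                  ⊎ (∃[ k ] m ℕ.+ suc k ≡ n × m ⊖ n ≡ -[1+ k ])
  ⊖-cases zero    zero    = inj₁ (0 , refl , refl)
  ⊖-cases (suc m) zero    = inj₁ (suc m , refl , refl)
  ⊖-cases zero    (suc n) = inj₂ (n , refl , refl)
  ⊖-cases (suc m) (suc n) rewrite ℤP.[1+m]⊖[1+n]≡m⊖n m n with ⊖-cases m n
  ... | inj₁ (k , n+k≡m , eq)   = inj₁ (k , cong suc n+k≡m , eq)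
  ... | inj₂ (k , m+1+k≡n , eq) = inj₂ (k , cong suc m+1+k≡n , eq)

  -- The superscripts give the signs of (p , q) in the two summands.
  private
    nonneg′-⁺⁺+⁺⁻ : ∀ P Q R S → suc S √5≤ R → NonNeg√5′ (+ P ℤ.+ + R) (+ Q ℤ.+ -[1+ S ])
    nonneg′-⁺⁺+⁺⁻ P Q R S h with ⊖-cases Q (suc S)
    ... | inj₁ (k , _ , eq)      = subst (NonNeg√5′ (+ (P ℕ.+ R))) (sym eq) tt
    ... | inj₂ (k , Q+1+k≡S , eq) = subst (NonNeg√5′ (+ (P ℕ.+ R))) (sym eq)
      (√5≤-mono h (ℕP.m≤n+m R P) (subst (suc k ℕ.≤_) Q+1+k≡S (ℕP.m≤n+m (suc k) Q)))

    nonneg′-⁺⁺+⁻⁺ : ∀ P Q R S → suc R ≤√5 S → NonNeg√5′ (+ P ℤ.+ -[1+ R ]) (+ Q ℤ.+ + S)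
    nonneg′-⁺⁺+⁻⁺ P Q R S h with ⊖-cases P (suc R)
    ... | inj₁ (k , _ , eq)       = subst (λ p → NonNeg√5′ p (+ (Q ℕ.+ S))) (sym eq) tt
    ... | inj₂ (k , P+1+k≡R , eq) = subst (λ p → NonNeg√5′ p (+ (Q ℕ.+ S))) (sym eq)
      (≤√5-mono h (subst (suc k ℕ.≤_) P+1+k≡R (ℕP.m≤n+m (suc k) P)) (ℕP.m≤n+m S Q))

    nonneg′-⁺⁻+⁻⁺ : ∀ P Q R S → suc Q √5≤ P → suc R ≤√5 S →
                    NonNeg√5′ (+ P ℤ.+ -[1+ R ]) (-[1+ Q ] ℤ.+ + S)
    nonneg′-⁺⁻+⁻⁺ P Q R S h₁ h₂ with ⊖-cases P (suc R) | ⊖-cases S (suc Q)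
    ... | inj₁ (k , e , eq) | inj₁ (k′ , f , fq) = subst₂ NonNeg√5′ (sym eq) (sym fq) tt
    ... | inj₁ (k , e , eq) | inj₂ (k′ , f , fq) = subst₂ NonNeg√5′ (sym eq) (sym fq)
      (√5≤-cancel {suc R} {S} {k} {suc k′} (subst₂ _√5≤_ (sym f) (sym e) h₁) h₂)
    ... | inj₂ (k , e , eq) | inj₁ (k′ , f , fq) = subst₂ NonNeg√5′ (sym eq) (sym fq)
      (≤√5-cancel {P} {suc Q} {suc k} {k′} h₁ (subst₂ _≤√5_ (sym e) (sym f) h₂))
    ... | inj₂ (k , e , _) | inj₂ (k′ , f , _) = ⊥-elim (√5≤-<-≤√5-<-irrefl h₁
      (subst (P ℕ.<_) e (ℕP.m<m+n P ℕP.0<1+n)) h₂ (subst (S ℕ.<_) f (ℕP.m<m+n S ℕP.0<1+n)))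

  nonneg′-+ : ∀ p q r s → NonNeg√5′ p q → NonNeg√5′ r s → NonNeg√5′ (p ℤ.+ r) (q ℤ.+ s)
  nonneg′-+ (+ P)    (+ Q)    (+ R)    (+ S)    _  _  = tt
  nonneg′-+ (+ P)    (+ Q)    (+ R)    -[1+ S ] _  h₂ = nonneg′-⁺⁺+⁺⁻ P Q R S h₂
  nonneg′-+ (+ P)    (+ Q)    -[1+ R ] (+ S)    _  h₂ = nonneg′-⁺⁺+⁻⁺ P Q R S h₂
  nonneg′-+ (+ P)    -[1+ Q ] (+ R)    (+ S)    h₁ _  =
    subst₂ NonNeg√5′ (ℤP.+-comm (+ R) (+ P)) (ℤP.+-comm (+ S) -[1+ Q ]) (nonneg′-⁺⁺+⁺⁻ R S P Q h₁)
  nonneg′-+ (+ P)    -[1+ Q ] (+ R)    -[1+ S ] h₁ h₂ =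
    subst (_√5≤ P ℕ.+ R) (cong suc (ℕP.+-suc Q S)) (√5≤-+ {P} {suc Q} {R} {suc S} h₁ h₂)
  nonneg′-+ (+ P)    -[1+ Q ] -[1+ R ] (+ S)    h₁ h₂ = nonneg′-⁺⁻+⁻⁺ P Q R S h₁ h₂
  nonneg′-+ -[1+ P ] (+ Q)    (+ R)    (+ S)    h₁ _  =
    subst₂ NonNeg√5′ (ℤP.+-comm (+ R) -[1+ P ]) (ℤP.+-comm (+ S) (+ Q)) (nonneg′-⁺⁺+⁻⁺ R S P Q h₁)
  nonneg′-+ -[1+ P ] (+ Q)    (+ R)    -[1+ S ] h₁ h₂ =
    subst₂ NonNeg√5′ (ℤP.+-comm (+ R) -[1+ P ]) (ℤP.+-comm -[1+ S ] (+ Q))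
      (nonneg′-⁺⁻+⁻⁺ R S P Q h₂ h₁)
  nonneg′-+ -[1+ P ] (+ Q)    -[1+ R ] (+ S)    h₁ h₂ =
    subst (_≤√5 Q ℕ.+ S) (cong suc (ℕP.+-suc P R)) (≤√5-+ {suc P} {Q} {suc R} {S} h₁ h₂)
  nonneg′-+ (+ P)    (+ Q)    -[1+ R ] -[1+ S ] _  ()
  nonneg′-+ (+ P)    -[1+ Q ] -[1+ R ] -[1+ S ] _  ()
  nonneg′-+ -[1+ P ] (+ Q)    -[1+ R ] -[1+ S ] _  ()
  nonneg′-+ -[1+ P ] -[1+ Q ] _        _        ()  _

  -- (p + q√5)·√5 = 5q + p√5
  nonneg′-*√5 : ∀ p q → NonNeg√5′ p q → NonNeg√5′ (+ 5 ℤ.* q) p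
  nonneg′-*√5 (+ P)    (+ Q)    _ = subst (λ r → NonNeg√5′ r (+ P)) (ℤP.pos-* 5 Q) tt
  nonneg′-*√5 (+ P)    -[1+ Q ] h = √5≤⇒5*≤√5 P (suc Q) h
  nonneg′-*√5 -[1+ P ] (+ Q)    h =
    subst (λ r → NonNeg√5′ r -[1+ P ]) (ℤP.pos-* 5 Q) (≤√5⇒√5≤ (suc P) Q h)

  nonneg′-half : ∀ p q → NonNeg√5′ (p ℤ.+ p) (q ℤ.+ q) → NonNeg√5′ p q
  nonneg′-half (+ P)    (+ Q)    _ = tt
  nonneg′-half (+ P)    -[1+ Q ] h =
    √5≤-half {P} {suc Q} (subst (_√5≤ P ℕ.+ P) (sym (cong suc (ℕP.+-suc Q Q))) h)
  nonneg′-half -[1+ P ] (+ Q)    h =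
    ≤√5-half {suc P} {Q} (subst (_≤√5 Q ℕ.+ Q) (sym (cong suc (ℕP.+-suc P P))) h)

  nonneg′? : ∀ p q → Dec (NonNeg√5′ p q)
  nonneg′? (+ P)    (+ Q)    = yes tt
  nonneg′? (+ P)    -[1+ Q ] = 5 ℕ.* (suc Q ℕ.* suc Q) ℕP.≤? P ℕ.* P
  nonneg′? -[1+ P ] (+ Q)    = suc P ℕ.* suc P ℕP.≤? 5 ℕ.* (Q ℕ.* Q)
  nonneg′? -[1+ P ] -[1+ Q ] = no λ ()

  nonneg′-total : ∀ p q → NonNeg√5′ p q ⊎ NonNeg√5′ (ℤ.- p) (ℤ.- q)
  nonneg′-total (+ P)    (+ Q)    = inj₁ tt
  nonneg′-total -[1+ P ] -[1+ Q ] = inj₂ tt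
  nonneg′-total (+ P)    -[1+ Q ] with nonneg′? (+ P) -[1+ Q ]
  ... | yes h = inj₁ h
  nonneg′-total (+ zero)    -[1+ Q ] | no _ = inj₂ tt
  nonneg′-total (+ suc P)   -[1+ Q ] | no h = inj₂ (ℕP.<⇒≤ (ℕP.≰⇒> h))
  nonneg′-total -[1+ P ] (+ Q)    with nonneg′? -[1+ P ] (+ Q)
  ... | yes h = inj₁ h
  nonneg′-total -[1+ P ] (+ zero)  | no _ = inj₂ tt
  nonneg′-total -[1+ P ] (+ suc Q) | no h = inj₂ (ℕP.<⇒≤ (ℕP.≰⇒> h))

  -- Antisymmetry is where the irrationality of √5 enters.
  nonneg′-antisym : ∀ p q → NonNeg√5′ p q → NonNeg√5′ (ℤ.- p) (ℤ.- q) → p ≡ + 0 × q ≡ + 0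
  nonneg′-antisym (+ zero)  (+ zero)  _ _ = refl , refl
  nonneg′-antisym (+ suc P) (+ zero)  _ ()
  nonneg′-antisym (+ zero)  (+ suc Q) _ ()
  nonneg′-antisym (+ suc P) (+ suc Q) _ ()
  nonneg′-antisym (+ zero)  -[1+ Q ]  () _
  nonneg′-antisym (+ suc P) -[1+ Q ]  h₁ h₂ =
    ⊥-elim (ℕP.1+n≢0 (√5-irrational (suc Q) (suc P) (ℕP.≤-antisym h₂ h₁)))
  nonneg′-antisym -[1+ P ]  (+ zero)  () _
  nonneg′-antisym -[1+ P ]  (+ suc Q) h₁ h₂ =
    ⊥-elim (ℕP.1+n≢0 (√5-irrational (suc Q) (suc P) (ℕP.≤-antisym h₁ h₂)))
  nonneg′-antisym -[1+ P ]  -[1+ Q ]  () _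


module GoldenNonNeg where

  open import Data.Nat using (zero; suc)
  open import Data.Integer as ℤ using (ℤ; +_)
  import Data.Integer.Properties as ℤP
  open import Data.Integer.Tactic.RingSolver using (solve-∀)
  open import Data.Product using (_×_; _,_; proj₂)
  open import Data.Sum using (_⊎_; inj₁; inj₂)
  open import Data.Unit using (tt)
  open import Data.Empty using (⊥-elim)
  open import Relation.Nullary using (¬_; Dec; yes; no)
  open import Relation.Binary.PropositionalEquality
  open SurdSign

  -- a + bφ ≥ 0 and a + bφ > 0; records, so that a and b are recovered by unification.
  record NonNeg (a b : ℤ) : Set where
    constructor nonneg
    field unNonNeg : NonNegφ (a , b)
  open NonNeg public

  record Pos (a b : ℤ) : Set where
    constructor pos
    field unPos : ¬ NonNeg (ℤ.- a) (ℤ.- b)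
  open Pos public

  -- a + bφ = (p + q√5)/2 with p = 2a + b and q = b.
  private
    p : ℤ → ℤ → ℤ
    p a b = + 2 ℤ.* a ℤ.+ b

    toSurd : ∀ {a b} → NonNeg a b → NonNeg√5′ (p a b) b
    toSurd {a} {b} h = NonNeg√5⇒NonNeg√5′ (p a b) b (unNonNeg h)

    fromSurd : ∀ {a b} → NonNeg√5′ (p a b) b → NonNeg a b
    fromSurd {a} {b} h = nonneg (NonNeg√5′⇒NonNeg√5 (p a b) b h)

    p-neg : ∀ a b → + 2 ℤ.* (ℤ.- a) ℤ.+ ℤ.- b ≡ ℤ.- (+ 2 ℤ.* a ℤ.+ b)
    p-neg = solve-∀

  nonneg-0 : NonNeg (+ 0) (+ 0)
  nonneg-0 = fromSurd tt

  nonneg-ℕ : ∀ k l → NonNeg (+ k) (+ l)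
  nonneg-ℕ k l = fromSurd (subst (λ r → NonNeg√5′ (r ℤ.+ + l) (+ l)) (ℤP.pos-* 2 k) tt)

  nonneg-+ : ∀ {a b c d} → NonNeg a b → NonNeg c d → NonNeg (a ℤ.+ c) (b ℤ.+ d)
  nonneg-+ {a} {b} {c} {d} h₁ h₂ = fromSurd
    (subst (λ r → NonNeg√5′ r (b ℤ.+ d)) (p-+ a b c d)
      (nonneg′-+ (p a b) b (p c d) d (toSurd h₁) (toSurd h₂)))
    where
    p-+ : ∀ a b c d → (+ 2 ℤ.* a ℤ.+ b) ℤ.+ (+ 2 ℤ.* c ℤ.+ d) ≡ + 2 ℤ.* (a ℤ.+ c) ℤ.+ (b ℤ.+ d)
    p-+ = solve-∀

  -- With x = p + q√5:  2·xφ = x + x√5 = (p + 5q) + (p + q)√5.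
  nonneg-*φ : ∀ {a b} → NonNeg a b → NonNeg b (a ℤ.+ b)
  nonneg-*φ {a} {b} h = fromSurd (nonneg′-half (p b (a ℤ.+ b)) (a ℤ.+ b)
    (subst₂ NonNeg√5′ (p-*φ a b) (q-*φ a b)
      (nonneg′-+ (p a b) b (+ 5 ℤ.* b) (p a b) (toSurd h) (nonneg′-*√5 (p a b) b (toSurd h)))))
    where
    p-*φ : ∀ a b → (+ 2 ℤ.* a ℤ.+ b) ℤ.+ + 5 ℤ.* b ≡
                   (+ 2 ℤ.* b ℤ.+ (a ℤ.+ b)) ℤ.+ (+ 2 ℤ.* b ℤ.+ (a ℤ.+ b))
    p-*φ = solve-∀
    q-*φ : ∀ a b → b ℤ.+ (+ 2 ℤ.* a ℤ.+ b) ≡ (a ℤ.+ b) ℤ.+ (a ℤ.+ b)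
    q-*φ = solve-∀

  nonneg? : ∀ a b → Dec (NonNeg a b)
  nonneg? a b with nonneg′? (p a b) b
  ... | yes h = yes (fromSurd h)
  ... | no ¬h = no λ h → ¬h (toSurd h)

  nonneg-total : ∀ a b → NonNeg a b ⊎ NonNeg (ℤ.- a) (ℤ.- b)
  nonneg-total a b with nonneg′-total (p a b) b
  ... | inj₁ h = inj₁ (fromSurd h)
  ... | inj₂ h = inj₂ (fromSurd (subst (λ r → NonNeg√5′ r (ℤ.- b)) (sym (p-neg a b)) h))

  nonneg-antisym : ∀ {a b} → NonNeg a b → NonNeg (ℤ.- a) (ℤ.- b) → a ≡ + 0 × b ≡ + 0
  nonneg-antisym {a} {b} h₁ h₂
    with nonneg′-antisym (p a b) b (toSurd h₁) (subst (λ r → NonNeg√5′ r (ℤ.- b)) (p-neg a b) (toSurd h₂))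
  ... | 2a+0≡0 , refl = ℤP.*-cancelˡ-≡ (+ 2) a (+ 0) (trans (sym (ℤP.+-identityʳ (+ 2 ℤ.* a))) 2a+0≡0) , refl

  pos⇒nonneg : ∀ {a b} → Pos a b → NonNeg a b
  pos⇒nonneg {a} {b} (pos h) with nonneg-total a b
  ... | inj₁ h′ = h′
  ... | inj₂ h′ = ⊥-elim (h h′)

  -- a + bφ with b ≠ 0 is irrational, hence not zero.
  nonneg⇒pos : ∀ {a b} → NonNeg a b → b ≢ + 0 → Pos a b
  nonneg⇒pos h b≢0 = pos λ h′ → b≢0 (proj₂ (nonneg-antisym h h′))

  pos-+-nonneg : ∀ {a b c d} → Pos a b → NonNeg c d → Pos (a ℤ.+ c) (b ℤ.+ d)
  pos-+-nonneg {a} {b} {c} {d} (pos h) h′ =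
    pos λ h″ → h (subst₂ NonNeg (cancel a c) (cancel b d) (nonneg-+ h″ h′))
    where
    cancel : ∀ x y → ℤ.- (x ℤ.+ y) ℤ.+ y ≡ ℤ.- x
    cancel = solve-∀

  -- φ⁻¹ = φ - 1, so (a + bφ)φ⁻¹ = (b - a) + aφ.
  private
    *φ⁻¹*φ : ∀ a b → ℤ.- (b ℤ.- a) ℤ.+ ℤ.- a ≡ ℤ.- b
    *φ⁻¹*φ = solve-∀

  pos-*φ⁻¹ : ∀ {a b} → Pos a b → Pos (b ℤ.- a) a
  pos-*φ⁻¹ {a} {b} (pos h) = pos λ h′ → h (subst (NonNeg _) (*φ⁻¹*φ a b) (nonneg-*φ h′))

  nonneg-*φ⁻¹ : ∀ {a b} → NonNeg a b → NonNeg (b ℤ.- a) a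
  nonneg-*φ⁻¹ {a} {b} h with nonneg-total (b ℤ.- a) a
  ... | inj₁ h′ = h′
  ... | inj₂ h′ with nonneg-antisym h (subst (NonNeg _) (*φ⁻¹*φ a b) (nonneg-*φ h′))
  ... | refl , refl = nonneg-0

  nonneg-scale : ∀ k {a b} → NonNeg a b → NonNeg (+ k ℤ.* a) (+ k ℤ.* b)
  nonneg-scale zero    h = nonneg-0
  nonneg-scale (suc k) {a} {b} h = subst₂ NonNeg (suc-* a (+ k)) (suc-* b (+ k)) (nonneg-+ h (nonneg-scale k h))
    where
    suc-* : ∀ a k → a ℤ.+ k ℤ.* a ≡ (+ 1 ℤ.+ k) ℤ.* a
    suc-* = solve-∀


module GoldenArithmetic where

  open import Data.Nat using (ℕ; suc)
  open import Data.Integer as ℤ using (+_)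
  import Data.Integer.Properties as ℤP
  open import Data.Integer.Tactic.RingSolver using (solve-∀)
  open import Data.Product using (_,_)
  open import Relation.Binary.PropositionalEquality

  +φ-identityˡ : ∀ x → fromℤ (+ 0) +φ x ≡ x
  +φ-identityˡ (a , b) = cong₂ _,_ (ℤP.+-identityˡ a) (ℤP.+-identityˡ b)

  +φ-identityʳ : ∀ x → x +φ fromℤ (+ 0) ≡ x
  +φ-identityʳ (a , b) = cong₂ _,_ (ℤP.+-identityʳ a) (ℤP.+-identityʳ b)

  +φ-assoc : ∀ x y z → (x +φ y) +φ z ≡ x +φ (y +φ z)
  +φ-assoc (a , b) (c , d) (e , f) = cong₂ _,_ (ℤP.+-assoc a c e) (ℤP.+-assoc b d f)

  +φ-comm : ∀ x y → x +φ y ≡ y +φ x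
  +φ-comm (a , b) (c , d) = cong₂ _,_ (ℤP.+-comm a c) (ℤP.+-comm b d)

  -φ-+φ-cancel : ∀ x y → (x -φ y) +φ y ≡ x
  -φ-+φ-cancel (a , b) (c , d) = cong₂ _,_ (cancel a c) (cancel b d)
    where
    cancel : ∀ a c → a ℤ.- c ℤ.+ c ≡ a
    cancel = solve-∀

  -φ-self : ∀ x → x -φ x ≡ fromℤ (+ 0)
  -φ-self (a , b) = cong₂ _,_ (ℤP.+-inverseʳ a) (ℤP.+-inverseʳ b)


  scale : ℕ → ℤφ → ℤφ
  scale K (a , b) = + K ℤ.* a , + K ℤ.* b

  scale-suc : ∀ K μ → scale (suc K) μ ≡ μ +φ scale K μ
  scale-suc K (a , b) = cong₂ _,_ (ℤP.suc-* (+ K) a) (ℤP.suc-* (+ K) b)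

  +φ-scale-0 : ∀ x μ → x +φ scale 0 μ ≡ x
  +φ-scale-0 (a , b) (c , d) =
    cong₂ _,_ (trans (cong (ℤ._+_ a) (ℤP.*-zeroˡ c)) (ℤP.+-identityʳ a))
              (trans (cong (ℤ._+_ b) (ℤP.*-zeroˡ d)) (ℤP.+-identityʳ b))

module GoldenOrder where

  open import Data.Integer as ℤ using (+_)
  import Data.Integer.Properties as ℤP
  open import Data.Integer.Tactic.RingSolver using (solve-∀)
  open import Data.Product using (_,_; proj₁; proj₂)
  open import Relation.Nullary using (¬_; Dec; yes; no; contradiction)
  open import Relation.Binary.PropositionalEquality
  open GoldenNonNeg
  open GoldenArithmetic using (+φ-identityˡ; +φ-comm)

  infix 4 _≤′_ _<′_ _≤?_

  -- Records, so that x and y can be inferred.  The field of x ≤′ y is x ≤φ y itself.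
  record _≤′_ (x y : ℤφ) : Set where
    constructor le
    field unle : NonNeg (proj₁ y ℤ.- proj₁ x) (proj₂ y ℤ.- proj₂ x)
  open _≤′_ public

  record _<′_ (x y : ℤφ) : Set where
    constructor lt
    field unlt : Pos (proj₁ y ℤ.- proj₁ x) (proj₂ y ℤ.- proj₂ x)
  open _<′_ public

  ≤φ⇒≤′ : ∀ {x y} → x ≤φ y → x ≤′ y
  ≤φ⇒≤′ h = le (nonneg h)

  ≤′⇒≤φ : ∀ {x y} → x ≤′ y → x ≤φ y
  ≤′⇒≤φ (le (nonneg h)) = h

  private
    telescope : ∀ a b c → (b ℤ.- a) ℤ.+ (c ℤ.- b) ≡ c ℤ.- a
    telescope = solve-∀

    telescope′ : ∀ a b c → (c ℤ.- b) ℤ.+ (b ℤ.- a) ≡ c ℤ.- a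
    telescope′ = solve-∀

    interchange : ∀ a b c d → (c ℤ.- a) ℤ.+ (d ℤ.- b) ≡ (c ℤ.+ d) ℤ.- (a ℤ.+ b)
    interchange = solve-∀

    neg-sub : ∀ a b → ℤ.- (a ℤ.- b) ≡ b ℤ.- a
    neg-sub = solve-∀

    sub-self : ∀ a → a ℤ.- a ≡ + 0
    sub-self = solve-∀

  ≤-refl : ∀ {x} → x ≤′ x
  ≤-refl {a , b} = le (subst₂ NonNeg (sym (sub-self a)) (sym (sub-self b)) nonneg-0)

  ≤-trans : ∀ {x y z} → x ≤′ y → y ≤′ z → x ≤′ z
  ≤-trans {a , b} {c , d} {e , f} (le h₁) (le h₂) =
    le (subst₂ NonNeg (telescope a c e) (telescope b d f) (nonneg-+ h₁ h₂))

  <-≤-trans : ∀ {x y z} → x <′ y → y ≤′ z → x <′ z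
  <-≤-trans {a , b} {c , d} {e , f} (lt h₁) (le h₂) =
    lt (subst₂ Pos (telescope a c e) (telescope b d f) (pos-+-nonneg h₁ h₂))

  ≤-<-trans : ∀ {x y z} → x ≤′ y → y <′ z → x <′ z
  ≤-<-trans {a , b} {c , d} {e , f} (le h₁) (lt h₂) =
    lt (subst₂ Pos (telescope′ a c e) (telescope′ b d f) (pos-+-nonneg h₂ h₁))

  <⇒≤ : ∀ {x y} → x <′ y → x ≤′ y
  <⇒≤ (lt h) = le (pos⇒nonneg h)

  ≰⇒> : ∀ {x y} → ¬ (x ≤′ y) → y <′ x
  ≰⇒> {a , b} {c , d} x≰y = lt (pos λ h → x≰y (le (subst₂ NonNeg (neg-sub a c) (neg-sub b d) h)))

  <⇒≱ : ∀ {x y} → x <′ y → ¬ (y ≤′ x)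
  <⇒≱ {a , b} {c , d} (lt (pos h)) (le h′) = h (subst₂ NonNeg (sym (neg-sub c a)) (sym (neg-sub d b)) h′)

  _≤?_ : ∀ x y → Dec (x ≤′ y)
  (a , b) ≤? (c , d) with nonneg? (c ℤ.- a) (d ℤ.- b)
  ... | yes h = yes (le h)
  ... | no ¬h = no λ x≤y → ¬h (unle x≤y)

  +-mono-≤ : ∀ {x y u v} → x ≤′ y → u ≤′ v → x +φ u ≤′ y +φ v
  +-mono-≤ {a , b} {c , d} {e , f} {g , h} (le h₁) (le h₂) =
    le (subst₂ NonNeg (interchange a e c g) (interchange b f d h) (nonneg-+ h₁ h₂))

  +-mono-<-≤ : ∀ {x y u v} → x <′ y → u ≤′ v → x +φ u <′ y +φ v
  +-mono-<-≤ {a , b} {c , d} {e , f} {g , h} (lt h₁) (le h₂) =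
    lt (subst₂ Pos (interchange a e c g) (interchange b f d h) (pos-+-nonneg h₁ h₂))

  x<x+φa : ∀ x {a} → fromℤ (+ 0) <′ a → x <′ x +φ a
  x<x+φa x {a} a>0 = subst₂ _<′_ (+φ-identityˡ x) (+φ-comm a x) (+-mono-<-≤ a>0 (≤-refl {x}))

  fromℤ-mono-≤ : ∀ {a b} → a ℤ.≤ b → fromℤ a ≤′ fromℤ b
  fromℤ-mono-≤ a≤b = le (nonneg-0≤ (ℤP.i≤j⇒0≤j-i a≤b))
    where
    nonneg-0≤ : ∀ {x} → + 0 ℤ.≤ x → NonNeg x (+ 0)
    nonneg-0≤ (ℤ.+≤+ {n = n} _) = nonneg-ℕ n 0

  fromℤ-<-+1⇒≤ : ∀ {a b} → fromℤ a <′ fromℤ (b ℤ.+ + 1) → a ℤ.≤ b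
  fromℤ-<-+1⇒≤ {a} {b} a<b+1 with a ℤP.≤? b
  ... | yes a≤b = a≤b
  ... | no  a≰b = contradiction (fromℤ-mono-≤ b+1≤a) (<⇒≱ a<b+1)
    where
    b+1≤a : b ℤ.+ + 1 ℤ.≤ a
    b+1≤a = subst (ℤ._≤ a) (ℤP.+-comm (+ 1) b) (ℤP.i<j⇒suc[i]≤j (ℤP.≰⇒> a≰b))

  <′⇒<φ : ∀ {x y} → x <′ y → x <φ y
  <′⇒<φ x<y = ≤′⇒≤φ (<⇒≤ x<y) , λ { refl → <⇒≱ x<y ≤-refl }


module FloorMultiples where

  open import Data.Nat as ℕ using (ℕ; zero; suc)
  import Data.Nat.Properties as ℕP
  open import Data.Integer as ℤ using (ℤ; +_)
  import Data.Integer.Properties as ℤP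
  open import Data.Integer.Tactic.RingSolver using (solve-∀)
  open import Data.Product using (_×_; _,_; proj₁; proj₂)
  open import Data.Sum using (_⊎_; inj₁; inj₂)
  open import Relation.Nullary using (¬_; yes; no)
  open import Relation.Nullary.Decidable using (from-yes; from-no)
  open import Relation.Binary.PropositionalEquality
  open GoldenNonNeg
  open GoldenOrder

  infix 8 _·φ

  _·φ : ℕ → ℤφ
  j ·φ = + 0 , + j

  IsFloorφ : ℕ → ℤ → Set
  IsFloorφ j z = fromℤ z ≤′ j ·φ × j ·φ <′ fromℤ (z ℤ.+ + 1)

  fromℤ-*φ : ∀ m → fromℤ (+ m) *φ φ ≡ m ·φ
  fromℤ-*φ m = cong₂ _,_ (coord₁ (+ m)) (coord₂ (+ m))
    where
    coord₁ : ∀ m → m ℤ.* + 0 ℤ.+ + 0 ℤ.* + 1 ≡ + 0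
    coord₁ = solve-∀
    coord₂ : ∀ m → m ℤ.* + 1 ℤ.+ + 0 ℤ.* + 0 ℤ.+ + 0 ℤ.* + 1 ≡ m
    coord₂ = solve-∀

  isFloorφ⇒≤φ×<φ : ∀ m c → IsFloorφ m c →
                   fromℤ c ≤φ fromℤ (+ m) *φ φ × fromℤ (+ m) *φ φ <φ fromℤ (c ℤ.+ + 1)
  isFloorφ⇒≤φ×<φ m c (c≤mφ , mφ<c+1) =
    subst (fromℤ c ≤φ_) (sym (fromℤ-*φ m)) (≤′⇒≤φ c≤mφ) ,
    subst (_<φ fromℤ (c ℤ.+ + 1)) (sym (fromℤ-*φ m)) (<′⇒<φ mφ<c+1)

  isFloorφ-unique : ∀ {j z z′} → IsFloorφ j z → IsFloorφ j z′ → z ≡ z′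
  isFloorφ-unique (z≤jφ , jφ<z+1) (z′≤jφ , jφ<z′+1) =
    ℤP.≤-antisym (fromℤ-<-+1⇒≤ (≤-<-trans z≤jφ jφ<z′+1))
                 (fromℤ-<-+1⇒≤ (≤-<-trans z′≤jφ jφ<z+1))

  1≤φ : fromℤ (+ 1) ≤′ φ
  1≤φ = from-yes (fromℤ (+ 1) ≤? φ)

  φ<2 : φ <′ fromℤ (+ 2)
  φ<2 = ≰⇒> (from-no (fromℤ (+ 2) ≤? φ))

  ·φ-suc : ∀ j → j ·φ +φ φ ≡ suc j ·φ
  ·φ-suc j = cong (λ k → + 0 , + k) (ℕP.+-comm j 1)

  -- ⌊ j φ⌋ is computed incrementally: the increment δ j = ⌊(j+1)φ⌋ - ⌊jφ⌋ is 1 or 2, since 1 < φ < 2.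
  mutual
    ⌊_φ⌋ : ℕ → ℕ
    ⌊ zero  φ⌋ = 0
    ⌊ suc j φ⌋ = ⌊ j φ⌋ ℕ.+ δ j

    δ : ℕ → ℕ
    δ j with fromℤ (+ (⌊ j φ⌋ ℕ.+ 2)) ≤? suc j ·φ
    ... | yes _ = 2
    ... | no  _ = 1

  δ-cases : ∀ j → (δ j ≡ 2 × fromℤ (+ (⌊ j φ⌋ ℕ.+ 2)) ≤′ suc j ·φ)
                ⊎ (δ j ≡ 1 × ¬ fromℤ (+ (⌊ j φ⌋ ℕ.+ 2)) ≤′ suc j ·φ)
  δ-cases j with fromℤ (+ (⌊ j φ⌋ ℕ.+ 2)) ≤? suc j ·φ
  ... | yes h = inj₁ (refl , h)
  ... | no ¬h = inj₂ (refl , ¬h)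

  δ≡1⊎δ≡2 : ∀ j → δ j ≡ 1 ⊎ δ j ≡ 2
  δ≡1⊎δ≡2 j with δ-cases j
  ... | inj₁ (δ≡2 , _) = inj₂ δ≡2
  ... | inj₂ (δ≡1 , _) = inj₁ δ≡1

  isFloorφ-⌊⌋ : ∀ j → IsFloorφ j (+ ⌊ j φ⌋)
  isFloorφ-⌊⌋ zero    = ≤-refl , ≰⇒> (from-no (fromℤ (+ 1) ≤? 0 ·φ))
  isFloorφ-⌊⌋ (suc j) with isFloorφ-⌊⌋ j | δ-cases j
  ... | lower , upper | inj₁ (δ≡2 , lower′) rewrite δ≡2 =
    lower′ ,
    subst₂ _<′_ (·φ-suc j)
      (cong (λ k → fromℤ (+ k)) (trans (ℕP.+-assoc ⌊ j φ⌋ 1 2) (sym (ℕP.+-assoc ⌊ j φ⌋ 2 1))))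
      (+-mono-<-≤ upper (<⇒≤ φ<2))
  ... | lower , upper | inj₂ (δ≡1 , ¬lower′) rewrite δ≡1 =
    subst (fromℤ (+ (⌊ j φ⌋ ℕ.+ 1)) ≤′_) (·φ-suc j) (+-mono-≤ lower 1≤φ) ,
    subst (suc j ·φ <′_) (cong (λ k → fromℤ (+ k)) (sym (ℕP.+-assoc ⌊ j φ⌋ 1 1))) (≰⇒> ¬lower′)

  ⌊⌋-unique : ∀ {j a} → IsFloorφ j (+ a) → ⌊ j φ⌋ ≡ a
  ⌊⌋-unique {j} h = ℤP.+-injective (isFloorφ-unique (isFloorφ-⌊⌋ j) h)

  2-φ≥0 : NonNeg (+ 2) (ℤ.- + 1)
  2-φ≥0 = from-yes (nonneg? (+ 2) (ℤ.- + 1))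

  φ-1≥0 : NonNeg (ℤ.- + 1) (+ 1)
  φ-1≥0 = from-yes (nonneg? (ℤ.- + 1) (+ 1))

  -- Multiplying  n < (J+1)φ < n + 1  by φ⁻¹ = φ - 1 gives  n(φ - 1) < J + 1 < (n + 1)(φ - 1),
  -- and 1 < φ < 2 then pins down nφ and (n + 1)φ.
  isFloorφ-at-⌊⌋ : ∀ J n → IsFloorφ (suc J) (+ n) →
                   IsFloorφ n (+ (n ℕ.+ J)) × IsFloorφ (suc n) (+ (n ℕ.+ J ℕ.+ 2))
  isFloorφ-at-⌊⌋ J n (le n≤[J+1]φ , lt [J+1]φ<n+1) =
    (le (pos⇒nonneg (subst₂ Pos (lo₁ (+ n) (+ J)) (lo₂ (+ n)) (pos-+-nonneg [n+1]φ⁻¹>J+1 2-φ≥0))) ,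
     lt (subst₂ Pos (hi₁ (+ n) (+ J)) refl nφ⁻¹<J+1)) ,
    (le (pos⇒nonneg (subst₂ Pos (lo₁′ (+ n) (+ J)) (lo₂′ (+ n)) [n+1]φ⁻¹>J+1)) ,
     lt (subst₂ Pos (hi₁′ (+ n) (+ J)) (hi₂′ (+ n)) (pos-+-nonneg nφ⁻¹<J+1 2-φ≥0)))
    where
    [n+1]φ⁻¹>J+1 = pos-*φ⁻¹ [J+1]φ<n+1
    nφ⁻¹<J+1 = pos-*φ⁻¹ (nonneg⇒pos n≤[J+1]φ (λ ()))
    lo₁ : ∀ n J → ((+ 0 ℤ.- (+ 1 ℤ.+ J)) ℤ.- ((n ℤ.+ + 1) ℤ.- + 0)) ℤ.+ + 2 ≡ + 0 ℤ.- (n ℤ.+ J)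
    lo₁ = solve-∀
    lo₂ : ∀ n → ((n ℤ.+ + 1) ℤ.- + 0) ℤ.+ ℤ.- + 1 ≡ n ℤ.- + 0
    lo₂ = solve-∀
    hi₁ : ∀ n J → ((+ 1 ℤ.+ J) ℤ.- + 0) ℤ.- (+ 0 ℤ.- n) ≡ ((n ℤ.+ J) ℤ.+ + 1) ℤ.- + 0
    hi₁ = solve-∀
    lo₁′ : ∀ n J → (+ 0 ℤ.- (+ 1 ℤ.+ J)) ℤ.- ((n ℤ.+ + 1) ℤ.- + 0) ≡ + 0 ℤ.- ((n ℤ.+ J) ℤ.+ + 2)
    lo₁′ = solve-∀
    lo₂′ : ∀ n → (n ℤ.+ + 1) ℤ.- + 0 ≡ (+ 1 ℤ.+ n) ℤ.- + 0
    lo₂′ = solve-∀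
    hi₁′ : ∀ n J → (((+ 1 ℤ.+ J) ℤ.- + 0) ℤ.- (+ 0 ℤ.- n)) ℤ.+ + 2 ≡
                   (((n ℤ.+ J) ℤ.+ + 2) ℤ.+ + 1) ℤ.- + 0
    hi₁′ = solve-∀
    hi₂′ : ∀ n → (+ 0 ℤ.- n) ℤ.+ ℤ.- + 1 ≡ + 0 ℤ.- (+ 1 ℤ.+ n)
    hi₂′ = solve-∀

  isFloorφ-at-⌊⌋+2 : ∀ J n → IsFloorφ (suc J) (+ n) → IsFloorφ (suc (suc J)) (+ (n ℕ.+ 2)) →
                     IsFloorφ (n ℕ.+ 2) (+ (n ℕ.+ J ℕ.+ 3))
  isFloorφ-at-⌊⌋+2 J n (_ , lt [J+1]φ<n+1) (le n+2≤[J+2]φ , _) =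
    le (pos⇒nonneg (subst₂ Pos (lo₁ (+ n) (+ J)) (lo₂ (+ n)) (pos-+-nonneg [n+1]φ⁻¹>J+1 φ-1≥0))) ,
    lt (subst₂ Pos (hi₁ (+ n) (+ J)) refl [n+2]φ⁻¹<J+2)
    where
    [n+1]φ⁻¹>J+1 = pos-*φ⁻¹ [J+1]φ<n+1
    [n+2]φ⁻¹<J+2 = pos-*φ⁻¹ (nonneg⇒pos n+2≤[J+2]φ (λ ()))
    lo₁ : ∀ n J → ((+ 0 ℤ.- (+ 1 ℤ.+ J)) ℤ.- ((n ℤ.+ + 1) ℤ.- + 0)) ℤ.+ ℤ.- + 1 ≡
                  + 0 ℤ.- ((n ℤ.+ J) ℤ.+ + 3)
    lo₁ = solve-∀
    lo₂ : ∀ n → ((n ℤ.+ + 1) ℤ.- + 0) ℤ.+ + 1 ≡ (n ℤ.+ + 2) ℤ.- + 0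
    lo₂ = solve-∀
    hi₁ : ∀ n J → ((+ 2 ℤ.+ J) ℤ.- + 0) ℤ.- (+ 0 ℤ.- (n ℤ.+ + 2)) ≡
                  (((n ℤ.+ J) ℤ.+ + 3) ℤ.+ + 1) ℤ.- + 0
    hi₁ = solve-∀

  δ-at-⌊⌋ : ∀ J → δ ⌊ suc J φ⌋ ≡ 2
  δ-at-⌊⌋ J = ℕP.+-cancelˡ-≡ (n ℕ.+ J) (δ n) 2 (begin
    n ℕ.+ J ℕ.+ δ n      ≡⟨ cong (ℕ._+ δ n) (sym (⌊⌋-unique (proj₁ floors))) ⟩
    ⌊ suc n φ⌋           ≡⟨ ⌊⌋-unique (proj₂ floors) ⟩
    n ℕ.+ J ℕ.+ 2        ∎)
    where
    open ≡-Reasoning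
    n = ⌊ suc J φ⌋
    floors = isFloorφ-at-⌊⌋ J n (isFloorφ-⌊⌋ (suc J))

  δ-after-⌊⌋ : ∀ J → δ (suc J) ≡ 2 → δ (suc ⌊ suc J φ⌋) ≡ 1
  δ-after-⌊⌋ J δ≡2 = ℕP.+-cancelˡ-≡ (n ℕ.+ J ℕ.+ 2) (δ (suc n)) 1 (begin
    n ℕ.+ J ℕ.+ 2 ℕ.+ δ (suc n)  ≡⟨ cong (ℕ._+ δ (suc n)) (sym (⌊⌋-unique (proj₂ floors))) ⟩
    ⌊ suc (suc n) φ⌋             ≡⟨ cong ⌊_φ⌋ (ℕP.+-comm 2 n) ⟩
    ⌊ n ℕ.+ 2 φ⌋                 ≡⟨ ⌊⌋-unique (isFloorφ-at-⌊⌋+2 J n (isFloorφ-⌊⌋ (suc J)) floor[J+2]) ⟩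
    n ℕ.+ J ℕ.+ 3                ≡⟨ sym (ℕP.+-assoc (n ℕ.+ J) 2 1) ⟩
    n ℕ.+ J ℕ.+ 2 ℕ.+ 1          ∎)
    where
    open ≡-Reasoning
    n = ⌊ suc J φ⌋
    floors = isFloorφ-at-⌊⌋ J n (isFloorφ-⌊⌋ (suc J))
    floor[J+2] : IsFloorφ (suc (suc J)) (+ (n ℕ.+ 2))
    floor[J+2] = subst (λ k → IsFloorφ (suc (suc J)) (+ (n ℕ.+ k))) δ≡2 (isFloorφ-⌊⌋ (suc (suc J)))

module FibonacciWordAsBeattyWord where

  open import Data.Nat as ℕ using (ℕ; zero; suc; _∸_; z≤n; s≤s)
  import Data.Nat.Properties as ℕP
  open import Data.Nat.Tactic.RingSolver as ℕSolver using ()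
  open import Data.List using (List; []; _∷_; length; map; upTo; applyUpTo)
  import Data.List.Properties as ListP
  open import Function using (_∘_)
  open import Data.Product using (∃-syntax; _,_)
  open import Data.Sum using (inj₁; inj₂)
  open import Data.Empty using (⊥-elim)
  open import Relation.Binary.PropositionalEquality
  open GoldenOrder using (<⇒≱)
  open FloorMultiples

  letter : ℕ → ℕ
  letter i = 2 ∸ δ (suc i)

  letter≡0⇒δ≡2 : ∀ {j} → letter j ≡ 0 → δ (suc j) ≡ 2
  letter≡0⇒δ≡2 {j} eq with δ≡1⊎δ≡2 (suc j)
  ... | inj₂ δ≡2 = δ≡2
  ... | inj₁ δ≡1 with () ← trans (sym eq) (cong (2 ∸_) δ≡1)

  letter≡1+⇒δ≡1 : ∀ {j a} → letter j ≡ suc a → δ (suc j) ≡ 1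
  letter≡1+⇒δ≡1 {j} eq with δ≡1⊎δ≡2 (suc j)
  ... | inj₁ δ≡1 = δ≡1
  ... | inj₂ δ≡2 with () ← trans (sym eq) (cong (2 ∸_) δ≡2)

  letter-before-⌊⌋ : ∀ J {st} → suc st ≡ ⌊ suc J φ⌋ → letter st ≡ 0
  letter-before-⌊⌋ J eq = cong (2 ∸_) (trans (cong δ eq) (δ-at-⌊⌋ J))

  letter-at-⌊⌋ : ∀ J {st} → suc st ≡ ⌊ suc J φ⌋ → δ (suc J) ≡ 2 → letter (suc st) ≡ 1
  letter-at-⌊⌋ J eq δ≡2 = cong (2 ∸_) (trans (cong (λ k → δ (suc k)) eq) (δ-after-⌊⌋ J δ≡2))

  infix 4 _occursAt_

  _occursAt_ : List ℕ → ℕ → Set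
  w occursAt j = ∀ i → i ℕ.< length w → nth w i ≡ letter (j ℕ.+ i)

  occursAt-head : ∀ {a w j} → (a ∷ w) occursAt j → a ≡ letter j
  occursAt-head {j = j} occ = trans (occ 0 (s≤s z≤n)) (cong letter (ℕP.+-identityʳ j))

  occursAt-tail : ∀ {a w j} → (a ∷ w) occursAt j → w occursAt suc j
  occursAt-tail {j = j} occ i i<∣w∣ = trans (occ (suc i) (s≤s i<∣w∣)) (cong letter (ℕP.+-suc j i))

  occursAt-cons : ∀ {a w j} → a ≡ letter j → w occursAt suc j → (a ∷ w) occursAt j
  occursAt-cons {j = j} a≡ _   zero    _          = trans a≡ (cong letter (sym (ℕP.+-identityʳ j)))
  occursAt-cons {j = j} _  occ (suc i) (s≤s i<∣w∣) = trans (occ i i<∣w∣) (cong letter (sym (ℕP.+-suc j i)))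

  σ-occursAt : ∀ w j st → suc st ≡ ⌊ suc j φ⌋ → w occursAt j → σ w occursAt st
  σ-occursAt []          _ _  _ _   i ()
  σ-occursAt (zero ∷ w)  j st eq occ =
    occursAt-cons {j = st} (sym (letter-before-⌊⌋ j eq))
      (occursAt-cons {j = suc st} (sym (letter-at-⌊⌋ j eq δ≡2))
        (σ-occursAt w (suc j) (suc (suc st)) eq′ (occursAt-tail {j = j} occ)))
    where
    δ≡2 = letter≡0⇒δ≡2 (sym (occursAt-head {j = j} occ))
    eq′ : suc (suc (suc st)) ≡ ⌊ suc (suc j) φ⌋
    eq′ = trans (ℕP.+-comm 2 (suc st)) (cong₂ ℕ._+_ eq (sym δ≡2))
  σ-occursAt (suc a ∷ w) j st eq occ =
    occursAt-cons {j = st} (sym (letter-before-⌊⌋ j eq))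
      (σ-occursAt w (suc j) (suc st) eq′ (occursAt-tail {j = j} occ))
    where
    δ≡1 = letter≡1+⇒δ≡1 (sym (occursAt-head {j = j} occ))
    eq′ : suc (suc st) ≡ ⌊ suc (suc j) φ⌋
    eq′ = trans (ℕP.+-comm 1 (suc st)) (cong₂ ℕ._+_ eq (sym δ≡1))

  ⌊1φ⌋≡1 : ⌊ 1 φ⌋ ≡ 1
  ⌊1φ⌋≡1 with δ-cases 0
  ... | inj₂ (δ≡1 , _)  = δ≡1
  ... | inj₁ (_ , 2≤φ) = ⊥-elim (<⇒≱ φ<2 2≤φ)

  σ^-occursAt-0 : ∀ k → σ^ k (0 ∷ []) occursAt 0
  σ^-occursAt-0 zero    = occursAt-cons {j = 0} (sym (letter-before-⌊⌋ 0 (sym ⌊1φ⌋≡1))) λ _ ()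
  σ^-occursAt-0 (suc k) = σ-occursAt (σ^ k (0 ∷ [])) 0 0 (sym ⌊1φ⌋≡1) (σ^-occursAt-0 k)

  σ^-head : ∀ k → ∃[ w ] σ^ k (0 ∷ []) ≡ 0 ∷ w
  σ^-head zero = [] , refl
  σ^-head (suc k) with σ^-head k
  ... | w , eq rewrite eq = 1 ∷ σ w , refl

  length-σ : ∀ w → length w ℕ.≤ length (σ w)
  length-σ []          = z≤n
  length-σ (zero ∷ w)  = ℕP.m≤n⇒m≤1+n (s≤s (length-σ w))
  length-σ (suc a ∷ w) = s≤s (length-σ w)

  length-σ^ : ∀ k → k ℕ.< length (σ^ k (0 ∷ []))
  length-σ^ zero = s≤s z≤n
  length-σ^ (suc k) with σ^-head k | length-σ^ k
  ... | w , eq | k<∣σ^k∣ rewrite eq = s≤s (ℕP.≤-trans k<∣σ^k∣ (s≤s (length-σ w)))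

  fibword≡letter : ∀ i → fibword i ≡ letter i
  fibword≡letter i = σ^-occursAt-0 (suc i) i (ℕP.<-trans (ℕP.n<1+n i) (length-σ^ (suc i)))


  nth-applyUpTo : ∀ (f : ℕ → ℕ) n t → t ℕ.< n → nth (applyUpTo f n) t ≡ f t
  nth-applyUpTo f (suc n) zero    _         = refl
  nth-applyUpTo f (suc n) (suc t) (ℕ.s≤s t<n) = nth-applyUpTo (f ∘ suc) n t t<n

  nth-factor : ∀ i L t → t ℕ.< L → nth (factor i (i ℕ.+ L)) t ≡ fibword (i ℕ.+ t)
  nth-factor i L t t<L = begin
    nth (map (λ k → fibword (i ℕ.+ k)) (upTo (i ℕ.+ L ∸ i))) t
      ≡⟨ cong (λ n → nth (map (λ k → fibword (i ℕ.+ k)) (upTo n)) t) (ℕP.m+n∸m≡n i L) ⟩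
    nth (map (λ k → fibword (i ℕ.+ k)) (upTo L)) t
      ≡⟨ cong (λ w → nth w t) (ListP.map-applyUpTo (λ k → k) (λ k → fibword (i ℕ.+ k)) L) ⟩
    nth (applyUpTo (λ k → fibword (i ℕ.+ k)) L) t
      ≡⟨ nth-applyUpTo (λ k → fibword (i ℕ.+ k)) L t t<L ⟩
    fibword (i ℕ.+ t)
      ∎
    where open ≡-Reasoning

  2∸δ-injective : ∀ u v → 2 ∸ δ u ≡ 2 ∸ δ v → δ u ≡ δ v
  2∸δ-injective u v eq with δ≡1⊎δ≡2 u | δ≡1⊎δ≡2 v
  ... | inj₁ δu≡1 | inj₁ δv≡1 = trans δu≡1 (sym δv≡1)
  ... | inj₂ δu≡2 | inj₂ δv≡2 = trans δu≡2 (sym δv≡2)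
  ... | inj₁ δu≡1 | inj₂ δv≡2 with () ← trans (cong (2 ∸_) (sym δu≡1)) (trans eq (cong (2 ∸_) δv≡2))
  ... | inj₂ δu≡2 | inj₁ δv≡1 with () ← trans (cong (2 ∸_) (sym δu≡2)) (trans eq (cong (2 ∸_) δv≡1))

  factor-≡⇒δ-periodic : ∀ x m L → factor x (x ℕ.+ L) ≡ factor (x ℕ.+ m) (x ℕ.+ m ℕ.+ L) →
                        ∀ t → t ℕ.< L → δ (suc x ℕ.+ t) ≡ δ (suc x ℕ.+ t ℕ.+ m)
  factor-≡⇒δ-periodic x m L eq t t<L = begin
    δ (suc (x ℕ.+ t))            ≡⟨ 2∸δ-injective _ _ letters ⟩
    δ (suc (x ℕ.+ m ℕ.+ t))      ≡⟨ cong (δ ∘ suc) (ℕSolver.solve (x ∷ m ∷ t ∷ [])) ⟩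
    δ (suc (x ℕ.+ t ℕ.+ m))      ∎
    where
    open ≡-Reasoning
    letters : letter (x ℕ.+ t) ≡ letter (x ℕ.+ m ℕ.+ t)
    letters = begin
      letter (x ℕ.+ t)                    ≡⟨ sym (fibword≡letter (x ℕ.+ t)) ⟩
      fibword (x ℕ.+ t)                   ≡⟨ sym (nth-factor x L t t<L) ⟩
      nth (factor x (x ℕ.+ L)) t          ≡⟨ cong (λ w → nth w t) eq ⟩
      nth (factor (x ℕ.+ m) (x ℕ.+ m ℕ.+ L)) t  ≡⟨ nth-factor (x ℕ.+ m) L t t<L ⟩
      fibword (x ℕ.+ m ℕ.+ t)             ≡⟨ fibword≡letter (x ℕ.+ m ℕ.+ t) ⟩
      letter (x ℕ.+ m ℕ.+ t)              ∎

module GoldenPowers where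

  open import Data.Nat as ℕ using (ℕ; zero; suc)
  import Data.Nat.Properties as ℕP
  open import Data.Nat.Tactic.RingSolver as ℕSolver using ()
  open import Data.Integer as ℤ using (+_)
  open import Data.Integer.Tactic.RingSolver as ℤSolver using ()
  open import Data.List using (_∷_; [])
  open import Data.Product using (_,_)
  open import Relation.Nullary.Decidable using (from-no)
  open import Relation.Binary.PropositionalEquality
  open GoldenNonNeg

  F-suc-pos : ∀ k → 0 ℕ.< F (suc k)
  F-suc-pos zero    = ℕ.s≤s ℕ.z≤n
  F-suc-pos (suc k) = ℕP.≤-trans (F-suc-pos k) (ℕP.m≤m+n (F (suc k)) (F k))

  F-mono : ∀ k → F k ℕ.≤ F (suc k)
  F-mono zero    = ℕ.z≤n
  F-mono (suc k) = ℕP.m≤m+n (F (suc k)) (F k)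

  F-suc-suc≤2*F-suc : ∀ k → F (suc (suc k)) ℕ.≤ 2 ℕ.* F (suc k)
  F-suc-suc≤2*F-suc k = ℕP.+-monoʳ-≤ (F (suc k)) (ℕP.≤-trans (F-mono k) (ℕP.m≤m+n (F (suc k)) 0))

  data φ⁻ᵏ-View (k : ℕ) : Set where
    even : φinvPow k ≡ (+ F (suc k) , ℤ.- + F k) →
           F (suc k) ℕ.* F (suc k) ≡ F k ℕ.* F (suc (suc k)) ℕ.+ 1 →
           Pos (+ F (suc k)) (ℤ.- + F k) → φ⁻ᵏ-View k
    odd  : φinvPow k ≡ (ℤ.- + F (suc k) , + F k) →
           F k ℕ.* F (suc (suc k)) ≡ F (suc k) ℕ.* F (suc k) ℕ.+ 1 →
           Pos (ℤ.- + F (suc k)) (+ F k) → φ⁻ᵏ-View k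

  cassini-even→odd : ∀ a b → b ℕ.* b ≡ a ℕ.* (b ℕ.+ a) ℕ.+ 1 →
                     b ℕ.* ((b ℕ.+ a) ℕ.+ b) ≡ (b ℕ.+ a) ℕ.* (b ℕ.+ a) ℕ.+ 1
  cassini-even→odd a b cassini = begin
    b ℕ.* ((b ℕ.+ a) ℕ.+ b)                  ≡⟨ ℕSolver.solve (a ∷ b ∷ []) ⟩
    b ℕ.* b ℕ.+ (b ℕ.* a ℕ.+ b ℕ.* b)          ≡⟨ cong (ℕ._+ (b ℕ.* a ℕ.+ b ℕ.* b)) cassini ⟩
    a ℕ.* (b ℕ.+ a) ℕ.+ 1 ℕ.+ (b ℕ.* a ℕ.+ b ℕ.* b)  ≡⟨ ℕSolver.solve (a ∷ b ∷ []) ⟩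
    (b ℕ.+ a) ℕ.* (b ℕ.+ a) ℕ.+ 1            ∎
    where open ≡-Reasoning

  cassini-odd→even : ∀ a b → a ℕ.* (b ℕ.+ a) ≡ b ℕ.* b ℕ.+ 1 →
                     (b ℕ.+ a) ℕ.* (b ℕ.+ a) ≡ b ℕ.* ((b ℕ.+ a) ℕ.+ b) ℕ.+ 1
  cassini-odd→even a b cassini = begin
    (b ℕ.+ a) ℕ.* (b ℕ.+ a)                  ≡⟨ ℕSolver.solve (a ∷ b ∷ []) ⟩
    a ℕ.* (b ℕ.+ a) ℕ.+ (b ℕ.* b ℕ.+ b ℕ.* a)  ≡⟨ cong (ℕ._+ (b ℕ.* b ℕ.+ b ℕ.* a)) cassini ⟩
    b ℕ.* b ℕ.+ 1 ℕ.+ (b ℕ.* b ℕ.+ b ℕ.* a)    ≡⟨ ℕSolver.solve (a ∷ b ∷ []) ⟩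
    b ℕ.* ((b ℕ.+ a) ℕ.+ b) ℕ.+ 1            ∎
    where open ≡-Reasoning

  -- (φ - 1)(x - yφ) = -(x + y) + xφ  and  (φ - 1)(-x + yφ) = (x + y) - xφ
  private
    φ⁻¹*even₁ : ∀ x y → (ℤ.- + 1) ℤ.* x ℤ.+ + 1 ℤ.* (ℤ.- y) ≡ ℤ.- (x ℤ.+ y)
    φ⁻¹*even₁ = ℤSolver.solve-∀
    φ⁻¹*even₂ : ∀ x y → (ℤ.- + 1) ℤ.* (ℤ.- y) ℤ.+ + 1 ℤ.* x ℤ.+ + 1 ℤ.* (ℤ.- y) ≡ x
    φ⁻¹*even₂ = ℤSolver.solve-∀
    φ⁻¹*odd₁ : ∀ x y → (ℤ.- + 1) ℤ.* (ℤ.- x) ℤ.+ + 1 ℤ.* y ≡ x ℤ.+ y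
    φ⁻¹*odd₁ = ℤSolver.solve-∀
    φ⁻¹*odd₂ : ∀ x y → (ℤ.- + 1) ℤ.* y ℤ.+ + 1 ℤ.* (ℤ.- x) ℤ.+ + 1 ℤ.* y ≡ ℤ.- x
    φ⁻¹*odd₂ = ℤSolver.solve-∀
    even-pos : ∀ x y → ℤ.- y ℤ.- x ≡ ℤ.- (x ℤ.+ y)
    even-pos = ℤSolver.solve-∀
    odd-pos : ∀ x y → y ℤ.- ℤ.- x ≡ x ℤ.+ y
    odd-pos = ℤSolver.solve-∀

  φ⁻ᵏ-view : ∀ k → φ⁻ᵏ-View k
  φ⁻ᵏ-view zero = even refl refl (pos (from-no (nonneg? (ℤ.- + 1) (+ 0))))
  φ⁻ᵏ-view (suc k) with φ⁻ᵏ-view k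
  ... | even eq cassini φ⁻ᵏ>0 =
    odd (trans (cong ((φ -φ fromℤ (+ 1)) *φ_) eq)
               (cong₂ _,_ (φ⁻¹*even₁ (+ b) (+ a)) (φ⁻¹*even₂ (+ b) (+ a))))
        (cassini-even→odd a b cassini)
        (subst (λ x → Pos x (+ b)) (even-pos (+ b) (+ a)) (pos-*φ⁻¹ φ⁻ᵏ>0))
    where
    a = F k
    b = F (suc k)
  ... | odd eq cassini φ⁻ᵏ>0 =
    even (trans (cong ((φ -φ fromℤ (+ 1)) *φ_) eq)
                (cong₂ _,_ (φ⁻¹*odd₁ (+ b) (+ a)) (φ⁻¹*odd₂ (+ b) (+ a))))
         (cassini-odd→even a b cassini)
         (subst (λ x → Pos x (ℤ.- + b)) (odd-pos (+ b) (+ a)) (pos-*φ⁻¹ φ⁻ᵏ>0))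
    where
    a = F k
    b = F (suc k)

module FractionalParts where

  open import Data.Nat as ℕ using (ℕ; zero; suc; _∸_)
  import Data.Nat.Properties as ℕP
  open import Data.Integer as ℤ using (ℤ; +_)
  import Data.Integer.Properties as ℤP
  open import Data.Integer.Tactic.RingSolver using (solve-∀)
  open import Data.Product using (∃-syntax; _×_; _,_; proj₁; proj₂)
  open import Data.Empty using (⊥-elim)
  open import Relation.Nullary using (yes; no)
  open import Relation.Binary.PropositionalEquality
  open GoldenNonNeg
  open GoldenOrder
  open GoldenArithmetic
  open FloorMultiples

  infix 7 _φ-_

  _φ-_ : ℕ → ℤ → ℤφ
  y φ- z = ℤ.- z , + y

  fracφ : ℕ → ℤφ
  fracφ y = y φ- + ⌊ y φ⌋

  mφ-c : ∀ m c → fromℤ (+ m) *φ φ -φ fromℤ c ≡ m φ- c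
  mφ-c m c = trans (cong (_-φ fromℤ c) (fromℤ-*φ m))
                   (cong₂ _,_ (ℤP.+-identityˡ (ℤ.- c)) (ℤP.+-identityʳ (+ m)))

  ≤φ-frac⇒≤′ : ∀ {A} m c → A ≤φ fromℤ (+ m) *φ φ -φ fromℤ c → A ≤′ m φ- c
  ≤φ-frac⇒≤′ {A} m c h = subst (A ≤′_) (mφ-c m c) (≤φ⇒≤′ h)

  ≤φ-1-frac⇒≤′ : ∀ {A} m c → A ≤φ fromℤ (+ 1) -φ (fromℤ (+ m) *φ φ -φ fromℤ c) →
                 A ≤′ fromℤ (+ 1) -φ m φ- c
  ≤φ-1-frac⇒≤′ {A} m c h = subst (λ t → A ≤′ fromℤ (+ 1) -φ t) (mφ-c m c) (≤φ⇒≤′ h)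

  0≤fracφ : ∀ y → fromℤ (+ 0) ≤′ fracφ y
  0≤fracφ y = le (subst₂ NonNeg (shift (+ ⌊ y φ⌋)) refl (unle (proj₁ (isFloorφ-⌊⌋ y))))
    where
    shift : ∀ c → + 0 ℤ.- c ≡ ℤ.- c ℤ.- + 0
    shift = solve-∀

  fracφ<1 : ∀ y → fracφ y <′ fromℤ (+ 1)
  fracφ<1 y = lt (subst₂ Pos (shift (+ ⌊ y φ⌋)) refl (unlt (proj₂ (isFloorφ-⌊⌋ y))))
    where
    shift : ∀ c → (c ℤ.+ + 1) ℤ.- + 0 ≡ + 1 ℤ.- ℤ.- c
    shift = solve-∀

  isFloorφ-φ- : ∀ {y z} → fromℤ (+ 0) ≤′ y φ- z → y φ- z <′ fromℤ (+ 1) → IsFloorφ y z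
  isFloorφ-φ- {y} {z} (le 0≤) (lt <1) =
    le (subst₂ NonNeg (lower z) refl 0≤) , lt (subst₂ Pos (upper z) refl <1)
    where
    lower : ∀ z → ℤ.- z ℤ.- + 0 ≡ + 0 ℤ.- z
    lower = solve-∀
    upper : ∀ z → + 1 ℤ.- ℤ.- z ≡ (z ℤ.+ + 1) ℤ.- + 0
    upper = solve-∀

  Hits : ℕ → ℕ → ℤφ → ℤφ → Set
  Hits N y₀ c₀ A = ∃[ j ] j ℕ.< N × c₀ ≤′ fracφ (y₀ ℕ.+ j) × fracφ (y₀ ℕ.+ j) <′ c₀ +φ A

  -- The points (y₀ + j)φ - z, for j < p + q, are moved by the steps  e₁ = pφ - p′  (when j < q,
  -- replacing j by j + p) and  e₂ = q′ - qφ  (otherwise, replacing j by j - q).  Every step is at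
  -- least μ and at most A, so starting below c₀ the walk reaches [c₀, c₀ + A) within K steps, once Kμ
  -- exceeds the distance to cover.
  module Walk (p q : ℕ) (p′ q′ : ℤ) (A μ : ℤφ)
              (μ≤e₁ : μ ≤′ (ℤ.- p′ , + p)) (e₁≤A : (ℤ.- p′ , + p) ≤′ A)
              (μ≤e₂ : μ ≤′ (q′ , ℤ.- + q)) (e₂≤A : (q′ , ℤ.- + q) ≤′ A) where

    Reached : ℕ → ℤφ → Set
    Reached y₀ c₀ = ∃[ j ] ∃[ z ] j ℕ.< p ℕ.+ q × c₀ ≤′ (y₀ ℕ.+ j) φ- z × (y₀ ℕ.+ j) φ- z <′ c₀ +φ A

    record Step (y₀ j : ℕ) (z : ℤ) : Set where
      field
        j′   : ℕ
        z′   : ℤ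
        e    : ℤφ
        j′<  : j′ ℕ.< p ℕ.+ q
        μ≤e  : μ ≤′ e
        e≤A  : e ≤′ A
        move : (y₀ ℕ.+ j) φ- z +φ e ≡ (y₀ ℕ.+ j′) φ- z′

    step : ∀ y₀ j z → j ℕ.< p ℕ.+ q → Step y₀ j z
    step y₀ j z j<p+q with j ℕP.<? q
    ... | yes j<q = record
      { j′ = j ℕ.+ p ; z′ = z ℤ.+ p′ ; e = ℤ.- p′ , + p
      ; j′< = subst (j ℕ.+ p ℕ.<_) (ℕP.+-comm q p) (ℕP.+-monoˡ-< p j<q)
      ; μ≤e = μ≤e₁ ; e≤A = e₁≤A
      ; move = cong₂ _,_ (sym (ℤP.neg-distrib-+ z p′)) (cong +_ (ℕP.+-assoc y₀ j p))
      }
    ... | no j≮q = record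
      { j′ = j ∸ q ; z′ = z ℤ.- q′ ; e = q′ , ℤ.- + q
      ; j′< = ℕP.≤-<-trans (ℕP.m∸n≤m j q) j<p+q
      ; μ≤e = μ≤e₂ ; e≤A = e₂≤A
      ; move = cong₂ _,_ (neg-sub z q′) (trans (ℤP.m-n≡m⊖n (y₀ ℕ.+ j) q)
          (trans (ℤP.⊖-≥ (ℕP.≤-trans q≤j (ℕP.m≤n+m j y₀))) (cong +_ (ℕP.+-∸-assoc y₀ q≤j))))
      }
      where
      q≤j = ℕP.≮⇒≥ j≮q
      neg-sub : ∀ z q′ → ℤ.- z ℤ.+ q′ ≡ ℤ.- (z ℤ.- q′)
      neg-sub = solve-∀

    walk : ∀ K y₀ c₀ j z → j ℕ.< p ℕ.+ q → (y₀ ℕ.+ j) φ- z <′ c₀ →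
           c₀ <′ (y₀ ℕ.+ j) φ- z +φ scale K μ → Reached y₀ c₀
    walk zero    y₀ c₀ j z _ v<c₀ c₀<v =
      ⊥-elim (<⇒≱ v<c₀ (<⇒≤ (subst (c₀ <′_) (+φ-scale-0 _ μ) c₀<v)))
    walk (suc K) y₀ c₀ j z j<p+q v<c₀ c₀<v+[1+K]μ with step y₀ j z j<p+q
    ... | record { j′ = j′ ; z′ = z′ ; e = e ; j′< = j′< ; μ≤e = μ≤e ; e≤A = e≤A ; move = move }
      with c₀ ≤? (y₀ ℕ.+ j′) φ- z′
    ...   | yes c₀≤v′ = j′ , z′ , j′< , c₀≤v′ , subst (_<′ c₀ +φ A) move (+-mono-<-≤ v<c₀ e≤A)
    ...   | no  c₀≰v′ =
      walk K y₀ c₀ j′ z′ j′< (≰⇒> c₀≰v′) (<-≤-trans c₀<v+[1+K]μ v+[1+K]μ≤v′+Kμ)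
      where
      v = (y₀ ℕ.+ j) φ- z
      v+[1+K]μ≤v′+Kμ : v +φ scale (suc K) μ ≤′ (y₀ ℕ.+ j′) φ- z′ +φ scale K μ
      v+[1+K]μ≤v′+Kμ = subst₂ _≤′_
        (cong (v +φ_) (sym (scale-suc K μ)))
        (trans (sym (+φ-assoc v e (scale K μ))) (cong (_+φ scale K μ) move))
        (+-mono-≤ (≤-refl {v}) (+-mono-≤ μ≤e (≤-refl {scale K μ})))

    hits : ∀ K y₀ c₀ → 0 ℕ.< p ℕ.+ q → fromℤ (+ 0) <′ A → fromℤ (+ 2) ≤′ scale K μ →
           fromℤ (+ 0) ≤′ c₀ → c₀ +φ A ≤′ fromℤ (+ 1) → Hits (p ℕ.+ q) y₀ c₀ A
    hits K y₀ c₀ 0<p+q A>0 2≤Kμ 0≤c₀ c₀+A≤1 = toFracφ (walk K y₀ c₀ 0 z₀ 0<p+q v₀<c₀ c₀<v₀+Kμ)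
      where
      z₀ = + ⌊ y₀ φ⌋ ℤ.+ + 1
      y₀+0 : + (y₀ ℕ.+ 0) ≡ + y₀
      y₀+0 = cong +_ (ℕP.+-identityʳ y₀)
      shift₁ : ∀ c → (c ℤ.+ + 1) ℤ.- + 0 ≡ + 0 ℤ.- ℤ.- (c ℤ.+ + 1)
      shift₁ = solve-∀
      shift₂ : ∀ c → + 0 ℤ.- c ≡ ℤ.- (c ℤ.+ + 1) ℤ.- ℤ.- + 1
      shift₂ = solve-∀
      -- The walk starts at (y₀ + 0)φ - z₀ = fracφ y₀ - 1, which lies in [-1, 0).
      v₀<0 : (y₀ ℕ.+ 0) φ- z₀ <′ fromℤ (+ 0)
      v₀<0 = lt (subst₂ Pos (shift₁ (+ ⌊ y₀ φ⌋)) (cong (ℤ._-_ (+ 0)) (sym y₀+0))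
                            (unlt (proj₂ (isFloorφ-⌊⌋ y₀))))
      -1≤v₀ : fromℤ (ℤ.- + 1) ≤′ (y₀ ℕ.+ 0) φ- z₀
      -1≤v₀ = le (subst₂ NonNeg (shift₂ (+ ⌊ y₀ φ⌋)) (cong (ℤ._- + 0) (sym y₀+0))
                                (unle (proj₁ (isFloorφ-⌊⌋ y₀))))
      v₀<c₀ = <-≤-trans v₀<0 0≤c₀
      c₀<v₀+Kμ = <-≤-trans (x<x+φa c₀ A>0) (≤-trans c₀+A≤1 (+-mono-≤ -1≤v₀ 2≤Kμ))
      toFracφ : Reached y₀ c₀ → Hits (p ℕ.+ q) y₀ c₀ A
      toFracφ (j , z , j< , c₀≤v , v<c₀+A) =
        j , j< , subst (c₀ ≤′_) v≡frac c₀≤v , subst (_<′ c₀ +φ A) v≡frac v<c₀+A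
        where
        v≡frac : (y₀ ℕ.+ j) φ- z ≡ fracφ (y₀ ℕ.+ j)
        v≡frac = cong ((y₀ ℕ.+ j) φ-_) (isFloorφ-unique
          (isFloorφ-φ- (≤-trans 0≤c₀ c₀≤v) (<-≤-trans v<c₀+A c₀+A≤1)) (isFloorφ-⌊⌋ (y₀ ℕ.+ j)))


module Density where

  open import Data.Nat as ℕ using (ℕ; suc)
  import Data.Nat.Properties as ℕP
  open import Data.Integer as ℤ using (+_)
  import Data.Integer.Properties as ℤP
  open import Data.Integer.Tactic.RingSolver using (solve-∀)
  open import Data.Product using (_,_; map₁; map₂)
  open import Relation.Binary.PropositionalEquality
  open GoldenNonNeg
  open GoldenOrder
  open GoldenArithmetic using (scale)
  open GoldenPowers
  open FractionalParts

  2≤scale : ∀ K t {x y} → NonNeg x y →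
            + K ℤ.* x ℤ.- + 2 ≡ + t ℤ.* (x ℤ.- (y ℤ.- x)) → + K ℤ.* y ℤ.- + 0 ≡ + t ℤ.* (y ℤ.- x) →
            fromℤ (+ 2) ≤′ scale K (x , y)
  2≤scale K t μ≥0 eq₁ eq₂ =
    le (subst₂ NonNeg (sym eq₁) (sym eq₂) (nonneg-scale t (nonneg-*φ⁻¹ (nonneg-*φ⁻¹ μ≥0))))

  -- With K = 2(a + 2b), μ = ±(bφ - (a + b)) and Cassini's identity, Kμ - 2 = 2b·μφ⁻².
  module _ (a b : ℕ) where

    private
      α = + a
      β = + b
      K = 2 ℕ.* (a ℕ.+ 2 ℕ.* b)

      +K : + K ≡ + 2 ℤ.* (α ℤ.+ + 2 ℤ.* β)
      +K = trans (ℤP.pos-* 2 (a ℕ.+ 2 ℕ.* b)) (cong (λ t → + 2 ℤ.* (α ℤ.+ t)) (ℤP.pos-* 2 b))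

      +2b : + 2 ℤ.* β ≡ + (2 ℕ.* b)
      +2b = sym (ℤP.pos-* 2 b)

      cancel : ∀ x y → x ℤ.+ + 2 ℤ.* (y ℤ.- y) ≡ x
      cancel = solve-∀

      sub-0 : ∀ x → x ≡ x ℤ.- + 0
      sub-0 = solve-∀

    2≤scale-even : b ℕ.* b ≡ a ℕ.* (b ℕ.+ a) ℕ.+ 1 → NonNeg (ℤ.- (β ℤ.+ α)) β →
                   fromℤ (+ 2) ≤′ scale K (ℤ.- (β ℤ.+ α) , β)
    2≤scale-even cassini μ≥0 = 2≤scale K (2 ℕ.* b) μ≥0 coord₁ coord₂
      where
      open ≡-Reasoning
      X = ℤ.- (β ℤ.+ α) ℤ.- (β ℤ.- ℤ.- (β ℤ.+ α))
      2βX = + 2 ℤ.* β ℤ.* X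
      C = α ℤ.* (β ℤ.+ α) ℤ.+ + 1
      cassiniℤ : β ℤ.* β ≡ C
      cassiniℤ = trans (sym (ℤP.pos-* b b)) (trans (cong +_ cassini) (cong (ℤ._+ + 1) (ℤP.pos-* a (b ℕ.+ a))))
      expand : ∀ x y → + 2 ℤ.* (x ℤ.+ + 2 ℤ.* y) ℤ.* ℤ.- (y ℤ.+ x) ℤ.- + 2 ≡
                       + 2 ℤ.* y ℤ.* (ℤ.- (y ℤ.+ x) ℤ.- (y ℤ.- ℤ.- (y ℤ.+ x)))
                       ℤ.+ + 2 ℤ.* (y ℤ.* y ℤ.- (x ℤ.* (y ℤ.+ x) ℤ.+ + 1))
      expand = solve-∀
      expand₂ : ∀ x y → + 2 ℤ.* (x ℤ.+ + 2 ℤ.* y) ℤ.* y ℤ.- + 0 ≡ + 2 ℤ.* y ℤ.* (y ℤ.- ℤ.- (y ℤ.+ x))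
      expand₂ = solve-∀
      coord₁ : + K ℤ.* ℤ.- (β ℤ.+ α) ℤ.- + 2 ≡ + (2 ℕ.* b) ℤ.* X
      coord₁ = begin
        + K ℤ.* ℤ.- (β ℤ.+ α) ℤ.- + 2                        ≡⟨ cong (λ t → t ℤ.* ℤ.- (β ℤ.+ α) ℤ.- + 2) +K ⟩
        + 2 ℤ.* (α ℤ.+ + 2 ℤ.* β) ℤ.* ℤ.- (β ℤ.+ α) ℤ.- + 2  ≡⟨ expand α β ⟩
        2βX ℤ.+ + 2 ℤ.* (β ℤ.* β ℤ.- C)                      ≡⟨ cong (λ t → 2βX ℤ.+ + 2 ℤ.* (t ℤ.- C)) cassiniℤ ⟩
        2βX ℤ.+ + 2 ℤ.* (C ℤ.- C)                            ≡⟨ cancel 2βX C ⟩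
        2βX                                                  ≡⟨ cong (ℤ._* X) +2b ⟩
        + (2 ℕ.* b) ℤ.* X                                    ∎
      coord₂ : + K ℤ.* β ℤ.- + 0 ≡ + (2 ℕ.* b) ℤ.* (β ℤ.- ℤ.- (β ℤ.+ α))
      coord₂ = trans (cong (λ t → t ℤ.* β ℤ.- + 0) +K)
                     (trans (expand₂ α β) (cong (ℤ._* (β ℤ.- ℤ.- (β ℤ.+ α))) +2b))

    2≤scale-odd : a ℕ.* (b ℕ.+ a) ≡ b ℕ.* b ℕ.+ 1 → NonNeg (β ℤ.+ α) (ℤ.- β) →
                  fromℤ (+ 2) ≤′ scale K (β ℤ.+ α , ℤ.- β)
    2≤scale-odd cassini μ≥0 = 2≤scale K (2 ℕ.* b) μ≥0 coord₁ coord₂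
      where
      open ≡-Reasoning
      X = (β ℤ.+ α) ℤ.- (ℤ.- β ℤ.- (β ℤ.+ α))
      2βX = + 2 ℤ.* β ℤ.* X
      C = β ℤ.* β ℤ.+ + 1
      cassiniℤ : α ℤ.* (β ℤ.+ α) ≡ C
      cassiniℤ = trans (sym (ℤP.pos-* a (b ℕ.+ a))) (trans (cong +_ cassini) (cong (ℤ._+ + 1) (ℤP.pos-* b b)))
      expand : ∀ x y → + 2 ℤ.* (x ℤ.+ + 2 ℤ.* y) ℤ.* (y ℤ.+ x) ℤ.- + 2 ≡
                       + 2 ℤ.* y ℤ.* ((y ℤ.+ x) ℤ.- (ℤ.- y ℤ.- (y ℤ.+ x)))
                       ℤ.+ + 2 ℤ.* (x ℤ.* (y ℤ.+ x) ℤ.- (y ℤ.* y ℤ.+ + 1))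
      expand = solve-∀
      expand₂ : ∀ x y → + 2 ℤ.* (x ℤ.+ + 2 ℤ.* y) ℤ.* ℤ.- y ℤ.- + 0 ≡ + 2 ℤ.* y ℤ.* (ℤ.- y ℤ.- (y ℤ.+ x))
      expand₂ = solve-∀
      coord₁ : + K ℤ.* (β ℤ.+ α) ℤ.- + 2 ≡ + (2 ℕ.* b) ℤ.* X
      coord₁ = begin
        + K ℤ.* (β ℤ.+ α) ℤ.- + 2                            ≡⟨ cong (λ t → t ℤ.* (β ℤ.+ α) ℤ.- + 2) +K ⟩
        + 2 ℤ.* (α ℤ.+ + 2 ℤ.* β) ℤ.* (β ℤ.+ α) ℤ.- + 2      ≡⟨ expand α β ⟩
        2βX ℤ.+ + 2 ℤ.* (α ℤ.* (β ℤ.+ α) ℤ.- C)              ≡⟨ cong (λ t → 2βX ℤ.+ + 2 ℤ.* (t ℤ.- C)) cassiniℤ ⟩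
        2βX ℤ.+ + 2 ℤ.* (C ℤ.- C)                            ≡⟨ cancel 2βX C ⟩
        2βX                                                  ≡⟨ cong (ℤ._* X) +2b ⟩
        + (2 ℕ.* b) ℤ.* X                                    ∎
      coord₂ : + K ℤ.* ℤ.- β ℤ.- + 0 ≡ + (2 ℕ.* b) ℤ.* (ℤ.- β ℤ.- (β ℤ.+ α))
      coord₂ = trans (cong (λ t → t ℤ.* ℤ.- β ℤ.- + 0) +K)
                     (trans (expand₂ α β) (cong (ℤ._* (ℤ.- β ℤ.- (β ℤ.+ α))) +2b))

    -- Here φ⁻ᵏ = ±(β - αφ); the walk's steps are φ⁻ᵏ and μ = φ⁻ᵏ⁻¹.
    hits-even : b ℕ.* b ≡ a ℕ.* (b ℕ.+ a) ℕ.+ 1 → Pos β (ℤ.- α) → 0 ℕ.< b ℕ.+ a →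
                ∀ y₀ c₀ → fromℤ (+ 0) ≤′ c₀ → c₀ +φ (β , ℤ.- α) ≤′ fromℤ (+ 1) →
                Hits (b ℕ.+ a) y₀ c₀ (β , ℤ.- α)
    hits-even cassini A>0 0<b+a y₀ c₀ =
      hits K y₀ c₀ 0<b+a (lt (subst₂ Pos (sub-0 β) (sub-0 (ℤ.- α)) A>0)) (2≤scale-even cassini μ≥0)
      where
      μ≥0 : NonNeg (ℤ.- (β ℤ.+ α)) β
      μ≥0 = subst (λ x → NonNeg x β) (φ⁻¹-coord α β) (nonneg-*φ⁻¹ (pos⇒nonneg A>0))
        where
        φ⁻¹-coord : ∀ x y → ℤ.- x ℤ.- y ≡ ℤ.- (y ℤ.+ x)
        φ⁻¹-coord = solve-∀
      μ≤A : (ℤ.- (β ℤ.+ α) , β) ≤′ (β , ℤ.- α)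
      μ≤A = le (subst (λ x → NonNeg x (ℤ.- α ℤ.- β)) (φ⁻²-coord α β)
                      (nonneg-*φ⁻¹ (nonneg-*φ⁻¹ (pos⇒nonneg A>0))))
        where
        φ⁻²-coord : ∀ x y → y ℤ.- (ℤ.- x ℤ.- y) ≡ y ℤ.- ℤ.- (y ℤ.+ x)
        φ⁻²-coord = solve-∀
      open Walk b a (β ℤ.+ α) β (β , ℤ.- α) (ℤ.- (β ℤ.+ α) , β) ≤-refl μ≤A μ≤A ≤-refl

    hits-odd : a ℕ.* (b ℕ.+ a) ≡ b ℕ.* b ℕ.+ 1 → Pos (ℤ.- β) α → 0 ℕ.< b ℕ.+ a →
               ∀ y₀ c₀ → fromℤ (+ 0) ≤′ c₀ → c₀ +φ (ℤ.- β , α) ≤′ fromℤ (+ 1) →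
               Hits (b ℕ.+ a) y₀ c₀ (ℤ.- β , α)
    hits-odd cassini A>0 0<b+a y₀ c₀ 0≤c₀ c₀+A≤1 =
      map₂ (map₁ (subst (ℕ._<_ _) (ℕP.+-comm a b)))
        (hits K y₀ c₀ (subst (0 ℕ.<_) (ℕP.+-comm b a) 0<b+a) (lt (subst₂ Pos (sub-0 (ℤ.- β)) (sub-0 α) A>0))
              (2≤scale-odd cassini μ≥0) 0≤c₀ c₀+A≤1)
      where
      μ≥0 : NonNeg (β ℤ.+ α) (ℤ.- β)
      μ≥0 = subst (λ x → NonNeg x (ℤ.- β)) (φ⁻¹-coord α β) (nonneg-*φ⁻¹ (pos⇒nonneg A>0))
        where
        φ⁻¹-coord : ∀ x y → x ℤ.- ℤ.- y ≡ y ℤ.+ x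
        φ⁻¹-coord = solve-∀
      μ≤A : (β ℤ.+ α , ℤ.- β) ≤′ (ℤ.- β , α)
      μ≤A = le (subst (λ x → NonNeg x (α ℤ.- ℤ.- β)) (φ⁻²-coord α β)
                      (nonneg-*φ⁻¹ (nonneg-*φ⁻¹ (pos⇒nonneg A>0))))
        where
        φ⁻²-coord : ∀ x y → ℤ.- y ℤ.- (x ℤ.- ℤ.- y) ≡ ℤ.- y ℤ.- (y ℤ.+ x)
        φ⁻²-coord = solve-∀
      open Walk a b β (β ℤ.+ α) (ℤ.- β , α) (β ℤ.+ α , ℤ.- β) μ≤A ≤-refl ≤-refl μ≤A

  fracφ-window : ∀ k y₀ c₀ → fromℤ (+ 0) ≤′ c₀ → c₀ +φ φinvPow k ≤′ fromℤ (+ 1) →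
                 Hits (F (suc (suc k))) y₀ c₀ (φinvPow k)
  fracφ-window k y₀ c₀ with φ⁻ᵏ-view k
  ... | even eq cassini A>0 rewrite eq = hits-even (F k) (F (suc k)) cassini A>0 (F-suc-pos (suc k)) y₀ c₀
  ... | odd  eq cassini A>0 rewrite eq = hits-odd  (F k) (F (suc k)) cassini A>0 (F-suc-pos (suc k)) y₀ c₀

module Carries where

  open import Data.Nat as ℕ using (ℕ; zero; suc)
  import Data.Nat.Properties as ℕP
  open import Data.Nat.Tactic.RingSolver as ℕSolver using ()
  open import Data.Integer as ℤ using (+_)
  import Data.Integer.Properties as ℤP
  open import Data.Integer.Tactic.RingSolver as ℤSolver using ()
  open import Data.Product using (∃-syntax; _×_; _,_)
  open import Data.Sum using (inj₁; inj₂)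
  open import Relation.Binary.PropositionalEquality
  open GoldenArithmetic
  open GoldenOrder
  open GoldenPowers using (F-suc-suc≤2*F-suc)
  open FloorMultiples
  open FibonacciWordAsBeattyWord
  open FractionalParts
  open Density

  record Carry (m e y : ℕ) : Set where
    constructor carry-≡
    field ⌊y+m⌋≡ : ⌊ y ℕ.+ m φ⌋ ≡ ⌊ y φ⌋ ℕ.+ ⌊ m φ⌋ ℕ.+ e

  carry-unique : ∀ {m e e′ y} → Carry m e y → Carry m e′ y → e ≡ e′
  carry-unique {m} {y = y} (carry-≡ c) (carry-≡ c′) =
    ℕP.+-cancelˡ-≡ (⌊ y φ⌋ ℕ.+ ⌊ m φ⌋) _ _ (trans (sym c) c′)

  carry : ∀ m e y → fromℤ (+ e) ≤′ fracφ y +φ fracφ m → fracφ y +φ fracφ m <′ fromℤ (+ suc e) →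
          Carry m e y
  carry m e y e≤Σ Σ<e+1 = carry-≡ (⌊⌋-unique
    ( subst₂ _≤′_ (cong (λ n → fromℤ (+ n)) (ℕP.+-comm e c)) Σ+c≡[y+m]φ (+-mono-≤ e≤Σ (≤-refl {fromℤ (+ c)}))
    , subst₂ _<′_ Σ+c≡[y+m]φ (cong (λ n → fromℤ (+ n)) (swap e c))
                  (+-mono-<-≤ Σ<e+1 (≤-refl {fromℤ (+ c)})) ))
    where
    c = ⌊ y φ⌋ ℕ.+ ⌊ m φ⌋
    swap : ∀ e c → suc e ℕ.+ c ≡ c ℕ.+ e ℕ.+ 1
    swap = ℕSolver.solve-∀
    Σ+c≡[y+m]φ : fracφ y +φ fracφ m +φ fromℤ (+ c) ≡ (y ℕ.+ m) ·φ
    Σ+c≡[y+m]φ = cong₂ _,_ (cancel (+ ⌊ y φ⌋) (+ ⌊ m φ⌋)) (ℤP.+-identityʳ (+ (y ℕ.+ m)))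
      where
      cancel : ∀ a b → ℤ.- a ℤ.+ ℤ.- b ℤ.+ (a ℤ.+ b) ≡ + 0
      cancel = ℤSolver.solve-∀

  carry-suc : ∀ {m e y} → δ y ≡ δ (y ℕ.+ m) → Carry m e y → Carry m e (suc y)
  carry-suc {m} {e} {y} δ-eq (carry-≡ c) = carry-≡ (begin
    ⌊ y ℕ.+ m φ⌋ ℕ.+ δ (y ℕ.+ m)              ≡⟨ cong₂ ℕ._+_ c (sym δ-eq) ⟩
    ⌊ y φ⌋ ℕ.+ ⌊ m φ⌋ ℕ.+ e ℕ.+ δ y           ≡⟨ swap ⌊ y φ⌋ ⌊ m φ⌋ e (δ y) ⟩
    ⌊ y φ⌋ ℕ.+ δ y ℕ.+ ⌊ m φ⌋ ℕ.+ e          ∎)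
    where
    open ≡-Reasoning
    swap : ∀ a b e d → a ℕ.+ b ℕ.+ e ℕ.+ d ≡ a ℕ.+ d ℕ.+ b ℕ.+ e
    swap = ℕSolver.solve-∀

  module _ {m a L} (periodic : ∀ t → t ℕ.< L → δ (a ℕ.+ t) ≡ δ (a ℕ.+ t ℕ.+ m)) where

    carry-between : ∀ {e s} t → s ℕ.≤ t → t ℕ.≤ L → Carry m e (a ℕ.+ s) → Carry m e (a ℕ.+ t)
    carry-between zero    ℕ.z≤n _ c = c
    carry-between {s = s} (suc t) s≤1+t 1+t≤L c with ℕP.m≤n⇒m<n∨m≡n s≤1+t
    ... | inj₂ refl        = c
    ... | inj₁ (ℕ.s≤s s≤t) = subst (Carry m _) (sym (ℕP.+-suc a t))
      (carry-suc (periodic t 1+t≤L) (carry-between t s≤t (ℕP.<⇒≤ 1+t≤L) c))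

    carry-constant : ∀ {e e′ s t} → s ℕ.≤ L → t ℕ.≤ L →
                     Carry m e (a ℕ.+ s) → Carry m e′ (a ℕ.+ t) → e ≡ e′
    carry-constant {s = s} {t} s≤L t≤L c c′ with ℕP.≤-total s t
    ... | inj₁ s≤t = carry-unique (carry-between t s≤t t≤L c) c′
    ... | inj₂ t≤s = sym (carry-unique (carry-between s t≤s s≤L c′) c)

  carry-0-in-window : ∀ k m y₀ → φinvPow k ≤′ fromℤ (+ 1) -φ fracφ m →
                      ∃[ j ] j ℕ.< F (suc (suc k)) × Carry m 0 (y₀ ℕ.+ j)
  carry-0-in-window k m y₀ A≤1-f = withCarry (fracφ-window k y₀ (fromℤ (+ 0)) ≤-refl 0+A≤1)
    where
    A = φinvPow k
    1-f+f≡1 = -φ-+φ-cancel (fromℤ (+ 1)) (fracφ m)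
    0+A≤1 : fromℤ (+ 0) +φ A ≤′ fromℤ (+ 1)
    0+A≤1 = subst₂ _≤′_ (trans (+φ-identityʳ A) (sym (+φ-identityˡ A))) 1-f+f≡1
                        (+-mono-≤ A≤1-f (0≤fracφ m))
    withCarry : Hits (F (suc (suc k))) y₀ (fromℤ (+ 0)) A →
                ∃[ j ] j ℕ.< F (suc (suc k)) × Carry m 0 (y₀ ℕ.+ j)
    withCarry (j , j< , 0≤y , y<0+A) = j , j< , carry m 0 (y₀ ℕ.+ j) (+-mono-≤ 0≤y (0≤fracφ m))
      (<-≤-trans (+-mono-<-≤ y<0+A (≤-refl {fracφ m}))
        (subst₂ _≤′_ (cong (_+φ fracφ m) (sym (+φ-identityˡ A))) 1-f+f≡1 (+-mono-≤ A≤1-f (≤-refl {fracφ m}))))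

  carry-1-in-window : ∀ k m y₀ → φinvPow k ≤′ fracφ m →
                      ∃[ j ] j ℕ.< F (suc (suc k)) × Carry m 1 (y₀ ℕ.+ j)
  carry-1-in-window k m y₀ A≤f =
    withCarry (fracφ-window k y₀ (fromℤ (+ 1) -φ A) 0≤1-A (subst (_≤′ fromℤ (+ 1)) (sym 1-A+A≡1) ≤-refl))
    where
    A = φinvPow k
    1-A+A≡1 = -φ-+φ-cancel (fromℤ (+ 1)) A
    0≤1-A : fromℤ (+ 0) ≤′ fromℤ (+ 1) -φ A
    0≤1-A = subst (_≤′ fromℤ (+ 1) -φ A) (-φ-self A)
                  (+-mono-≤ (<⇒≤ (≤-<-trans A≤f (fracφ<1 m))) (≤-refl { -φ A}))
    withCarry : Hits (F (suc (suc k))) y₀ (fromℤ (+ 1) -φ A) A →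
                ∃[ j ] j ℕ.< F (suc (suc k)) × Carry m 1 (y₀ ℕ.+ j)
    withCarry (j , j< , 1-A≤y , _) = j , j< , carry m 1 (y₀ ℕ.+ j)
      (subst (_≤′ fracφ (y₀ ℕ.+ j) +φ fracφ m) 1-A+A≡1 (+-mono-≤ 1-A≤y A≤f))
      (+-mono-<-≤ (fracφ<1 (y₀ ℕ.+ j)) (<⇒≤ (fracφ<1 m)))

  no-repeat : ∀ k m x → φinvPow k ≤′ fracφ m → φinvPow k ≤′ fromℤ (+ 1) -φ fracφ m →
              factor x (x ℕ.+ 2 ℕ.* F (suc k)) ≢ factor (x ℕ.+ m) (x ℕ.+ m ℕ.+ 2 ℕ.* F (suc k))
  no-repeat k m x A≤f A≤1-f eq =
    let j₁ , j₁< , carry₀ = carry-0-in-window k m (suc x) A≤1-f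
        j₂ , j₂< , carry₁ = carry-1-in-window k m (suc x) A≤f
    in ℕP.0≢1+n (carry-constant {m} {suc x} {L} (factor-≡⇒δ-periodic x m L eq)
                                (≤L j₁<) (≤L j₂<) carry₀ carry₁)
    where
    L = 2 ℕ.* F (suc k)
    ≤L : ∀ {j} → j ℕ.< F (suc (suc k)) → j ℕ.≤ L
    ≤L j< = ℕP.≤-trans (ℕP.<⇒≤ j<) (F-suc-suc≤2*F-suc k)

open FloorMultiples using (⌊_φ⌋; isFloorφ-⌊⌋; isFloorφ⇒≤φ×<φ)
open FractionalParts using (≤φ-frac⇒≤′; ≤φ-1-frac⇒≤′)
open Carries using (no-repeat)

proposition16 : (n ℓ : ℕ) → n ≥ 1 → ℓ ≥ 1 →
    ((k : ℤ) →
    fromℤ k ≤φ (fromℤ (+ (2 * ℓ * F n)) *φ φ) →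
    (fromℤ (+ (2 * ℓ * F n)) *φ φ) <φ fromℤ (k ℤ.+ + 1) →
    (φinvPow (n ∸ 1) ≤φ ((fromℤ (+ (2 * ℓ * F n)) *φ φ) -φ fromℤ k))
    × (φinvPow (n ∸ 1) ≤φ (fromℤ (+ 1) -φ ((fromℤ (+ (2 * ℓ * F n)) *φ φ) -φ fromℤ k)))) →
    (x : ℕ) →
    factor x (x + 2 * F n) ≢ factor (x + 2 * ℓ * F n) (x + 2 * ℓ * F n + 2 * F n)
proposition16 zero    _ () _
proposition16 (suc k) ℓ _ _ H x =
  no-repeat k m x (≤φ-frac⇒≤′ m c (proj₁ bounds)) (≤φ-1-frac⇒≤′ m c (proj₂ bounds))
  where
  m = 2 * ℓ * F (suc k)
  c = + ⌊ m φ⌋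
  bounds = uncurry (H c) (isFloorφ⇒≤φ×<φ m c (isFloorφ-⌊⌋ m))
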